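{- Every finite matroid of cyclic width at most $2$ is bitransversal.
   Context: A flat is cyclic if it is a (possibly empty) union of circuits; the cyclic width of $M$ is the maximum size of an antichain in the poset (under inclusion) of cyclic flats of $M$. A matroid is bitransversal if both it and its dual are transversal matroids. -}

module Defs where

open import Data.Nat using (ℕ; _≤_; _<_)
open import Data.Fin using (Fin)
open import Data.Fin.Subset
  using (Subset; ⊥; ⁅_⁆; _∈_; _∉_; _⊆_; _⊂_; ∁; _∪_; ∣_∣)
open import Data.Product using (Σ; ∃; _×_; _,_)
open import Relation.Nullary using (¬_; Dec)
open import Relation.Binary.PropositionalEquality using (_≡_; _≢_)
open import Function.Bundles using (_⇔_)

record Matroid (n : ℕ) : Set₁ where
  field
    Indep     : Subset n → Set
    Indep?    : (I : Subset n) → Dec (Indep I)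
    indep-⊥   : Indep ⊥
    indep-⊆   : ∀ {I J} → J ⊆ I → Indep I → Indep J
    augment   : ∀ {I J} → Indep I → Indep J → ∣ I ∣ < ∣ J ∣ →
                ∃ λ e → e ∈ J × e ∉ I × Indep (I ∪ ⁅ e ⁆)

module _ {n : ℕ} (M : Matroid n) where
  open Matroid M

  IsBasis : Subset n → Set
  IsBasis B = Indep B × (∀ J → Indep J → B ⊆ J → J ⊆ B)

  DualIndep : Subset n → Set
  DualIndep I = ∃ λ B → IsBasis B × I ⊆ ∁ B

  IsCircuit : Subset n → Set
  IsCircuit C = ¬ Indep C × (∀ D → D ⊂ C → Indep D)

  HasRank : Subset n → ℕ → Set
  HasRank X k = (∃ λ I → I ⊆ X × Indep I × ∣ I ∣ ≡ k)
              × (∀ I → I ⊆ X → Indep I → ∣ I ∣ ≤ k)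

  IsFlat : Subset n → Set
  IsFlat F = ∀ e → e ∉ F → ∀ k → HasRank F k → ¬ HasRank (F ∪ ⁅ e ⁆) k

  -- cyclic: a (possibly empty) union of circuits
  IsCyclic : Subset n → Set
  IsCyclic F = ∀ e → e ∈ F → ∃ λ C → IsCircuit C × e ∈ C × C ⊆ F

  IsCyclicFlat : Subset n → Set
  IsCyclicFlat F = IsFlat F × IsCyclic F

  IsCyclicFlatAntichain : (k : ℕ) → (Fin k → Subset n) → Set
  IsCyclicFlatAntichain k F =
    (∀ i → IsCyclicFlat (F i)) × (∀ i j → i ≢ j → ¬ (F i ⊆ F j))

  CyclicWidth≤ : ℕ → Set
  CyclicWidth≤ w = ∀ k (F : Fin k → Subset n) → IsCyclicFlatAntichain k F → k ≤ w

IsPartialTransversal : {n r : ℕ} → (Fin r → Subset n) → Subset n → Set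
IsPartialTransversal {n} {r} A I =
  Σ ((e : Fin n) → e ∈ I → Fin r) λ φ →
    (∀ e (p : e ∈ I) → e ∈ A (φ e p)) ×
    (∀ e e' (p : e ∈ I) (p' : e' ∈ I) → φ e p ≡ φ e' p' → e ≡ e')

IsTransversalIndep : {n : ℕ} → (Subset n → Set) → Set
IsTransversalIndep {n} P =
  ∃ λ r → Σ (Fin r → Subset n) λ A → ∀ I → P I ⇔ IsPartialTransversal A I

IsTransversal : {n : ℕ} → Matroid n → Set
IsTransversal M = IsTransversalIndep (Matroid.Indep M)

IsBitransversal : {n : ℕ} → Matroid n → Set
IsBitransversal M = IsTransversal M × IsTransversalIndep (DualIndep M)

-- Everything is phrased for rank functions (bounded, monotone, submodular maps on subsets of
-- E = Fin n), which describe M and M* alike: r*(X) = |X| + r(E − X) − r(E) is again a rank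
-- function, and its cyclic flats are the complements of those of r, so M* also has cyclic
-- width at most 2.
--
-- A rank function r is transversal as soon as there is a list L of cyclic flats such that
-- every X lies in at most r(E) − r(X) members of L, with equality when X is a cyclic flat.
-- Take the complements of the members of L as the set system: J meets |L| − #{Z ∈ L | J ⊆ Z}
-- of them, and |L| = r(E). By Hall's theorem the inequality makes every independent set a
-- partial transversal; conversely a minimal dependent subset J of a partial transversal is
-- cyclic, and counting at the cyclic flat it spans gives |J| ≤ r(J).
--
-- L is built from the top down: each cyclic flat W is added, with the multiplicity that makes
-- its count exact, after all cyclic flats above it; the multiplicity is nonnegative by the
-- inequality, and the inequality is where width 2 enters. The cyclic flats containing X all
-- contain one of at most two minimal ones W₁, W₂, so inclusion–exclusion, the cyclic flat V
-- spanned by W₁ ∪ W₂ and submodularity bound the count for X by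
-- (r(E) − r(W₁)) + (r(E) − r(W₂)) − (r(E) − r(V)) ≤ r(E) − r(W₁ ∩ W₂) ≤ r(E) − r(X).

{-# OPTIONS --safe #-}
module Submission where

open import Defs
open import Data.Bool.Properties using () renaming (_≟_ to _≟ᵇ_)
open import Data.Empty using (⊥-elim)
open import Data.Fin using (Fin; zero; suc)
open import Data.Fin.Properties using (all?) renaming (_≟_ to _≟ᶠ_)
open import Data.Fin.Subset
open import Data.Fin.Subset.Induction using (⊂-wellFounded; ⊃-wellFounded; Acc; acc)
open import Data.Fin.Subset.Properties
open import Data.List using (List; []; _∷_; _++_; replicate; length; lookup)
open import Data.List.Relation.Unary.All using (All; []; _∷_)
import Data.List.Relation.Unary.All as All
open import Data.List.Relation.Unary.All.Properties using (++⁺; replicate⁺)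
open import Data.Nat using (ℕ; zero; suc; _+_; _∸_; _≤_; _<_; z≤n; s≤s; _≤?_; _<?_)
open import Data.Nat.Induction using (<-wellFounded)
open import Data.Nat.Properties
open import Algebra.Properties.CommutativeSemigroup +-commutativeSemigroup using (interchange)
open import Data.Product using (∃; ∃₂; _×_; _,_; proj₁; proj₂)
open import Data.Sum using (_⊎_; inj₁; inj₂; [_,_]′)
open import Data.Vec using (_∷_; []; tabulate; here; there)
open import Data.Vec.Properties using (≡-dec; lookup∘tabulate; []=⇒lookup; lookup⇒[]=)
open import Function using (_∘_; id)
open import Function.Bundles using (_⇔_; mk⇔)
open import Function.Construct.Composition using (_⇔-∘_)
open import Function.Construct.Symmetry using (⇔-sym)
open import Relation.Nullary using (¬_; Dec; yes; no; does)
open import Relation.Nullary.Decidable using (_×-dec_; _→-dec_; ¬?; dec-true)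
open import Relation.Nullary.Negation using (contradiction)
open import Relation.Unary using (Decidable)
open import Relation.Binary.PropositionalEquality
  using (_≡_; _≢_; refl; sym; trans; cong; cong₂; subst; module ≡-Reasoning)

private
  variable
    n : ℕ

x∈p─q⇒x∉q : ∀ {x} (p q : Subset n) → x ∈ p ─ q → x ∉ q
x∈p─q⇒x∉q {x = zero}  (_ ∷ p) (inside  ∷ q) ()
x∈p─q⇒x∉q {x = zero}  (_ ∷ p) (outside ∷ q) _         ()
x∈p─q⇒x∉q {x = suc x} (_ ∷ p) (_       ∷ q) (there m) = x∈p─q⇒x∉q p q m ∘ drop-there

x∈p∪q∧x∉p⇒x∈q : ∀ {x} {p q : Subset n} → x ∈ p ∪ q → x ∉ p → x ∈ q
x∈p∪q∧x∉p⇒x∈q {p = p} {q} x∈p∪q x∉p with x∈p∪q⁻ p q x∈p∪q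
... | inj₁ x∈p = contradiction x∈p x∉p
... | inj₂ x∈q = x∈q

x∈p⇒⁅x⁆⊆p : ∀ {x} {p : Subset n} → x ∈ p → ⁅ x ⁆ ⊆ p
x∈p⇒⁅x⁆⊆p {x = x} x∈p y∈⁅x⁆ = subst (_∈ _) (sym (x∈⁅y⁆⇒x≡y x y∈⁅x⁆)) x∈p

∪-least : {p q s : Subset n} → p ⊆ s → q ⊆ s → p ∪ q ⊆ s
∪-least {p = p} {q} p⊆s q⊆s x∈p∪q with x∈p∪q⁻ p q x∈p∪q
... | inj₁ x∈p = p⊆s x∈p
... | inj₂ x∈q = q⊆s x∈q

∩-greatest : {p q s : Subset n} → s ⊆ p → s ⊆ q → s ⊆ p ∩ q
∩-greatest s⊆p s⊆q x∈s = x∈p∩q⁺ (s⊆p x∈s , s⊆q x∈s)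

p⊆q∪[p─q] : (p q : Subset n) → p ⊆ q ∪ (p ─ q)
p⊆q∪[p─q] p q {x} x∈p with x ∈? q
... | yes x∈q = x∈p∪q⁺ (inj₁ x∈q)
... | no  x∉q = x∈p∪q⁺ (inj₂ (x∈p∧x∉q⇒x∈p─q x∈p x∉q))

p⊆∁q⇒q⊆∁p : {p q : Subset n} → p ⊆ ∁ q → q ⊆ ∁ p
p⊆∁q⇒q⊆∁p p⊆∁q x∈q = x∉p⇒x∈∁p λ x∈p → x∈∁p⇒x∉p (p⊆∁q x∈p) x∈q

p⊆q-x∧x∈q⇒p∪⁅x⁆⊆q : ∀ {x} {p q : Subset n} → p ⊆ q - x → x ∈ q → p ∪ ⁅ x ⁆ ⊆ q
p⊆q-x∧x∈q⇒p∪⁅x⁆⊆q {x = x} {q = q} p⊆q-x x∈q = ∪-least (p─q⊆p q ⁅ x ⁆ ∘ p⊆q-x) (x∈p⇒⁅x⁆⊆p x∈q)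

p⊆q⇒p-x⊆q-x : ∀ {x} {p q : Subset n} → p ⊆ q → p - x ⊆ q - x
p⊆q⇒p-x⊆q-x {x = x} {p} p⊆q y∈p-x = x∈p∧x∉q⇒x∈p─q (p⊆q (p─q⊆p p ⁅ x ⁆ y∈p-x)) (x∈p─q⇒x∉q p ⁅ x ⁆ y∈p-x)

p⊆q∧p⊄q⇒q⊆p : {p q : Subset n} → p ⊆ q → p ⊄ q → q ⊆ p
p⊆q∧p⊄q⇒q⊆p {p = p} p⊆q p⊄q {x} x∈q with x ∈? p
... | yes x∈p = x∈p
... | no  x∉p = contradiction ((λ {y} → p⊆q {y}) , x , x∈q , x∉p) p⊄q

∈-tabulate⁺ : {P : Fin n → Set} (P? : Decidable P) {i : Fin n} → P i → i ∈ tabulate (does ∘ P?)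
∈-tabulate⁺ P? {i} Pi = lookup⇒[]= i _ (trans (lookup∘tabulate (does ∘ P?) i) (dec-true (P? i) Pi))

∈-tabulate⁻ : {P : Fin n → Set} (P? : Decidable P) {i : Fin n} → i ∈ tabulate (does ∘ P?) → P i
∈-tabulate⁻ P? {i} i∈ with P? i | trans (sym (lookup∘tabulate (does ∘ P?) i)) ([]=⇒lookup i∈)
... | yes Pi | _  = Pi
... | no  _  | ()

_≟ₛ_ : (X Y : Subset n) → Dec (X ≡ Y)
_≟ₛ_ = ≡-dec _≟ᵇ_

∣p∪q∣+∣p∩q∣≡∣p∣+∣q∣ : (p q : Subset n) → ∣ p ∪ q ∣ + ∣ p ∩ q ∣ ≡ ∣ p ∣ + ∣ q ∣
∣p∪q∣+∣p∩q∣≡∣p∣+∣q∣ []            []            = refl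
∣p∪q∣+∣p∩q∣≡∣p∣+∣q∣ (outside ∷ p) (outside ∷ q) = ∣p∪q∣+∣p∩q∣≡∣p∣+∣q∣ p q
∣p∪q∣+∣p∩q∣≡∣p∣+∣q∣ (outside ∷ p) (inside  ∷ q) =
  trans (cong suc (∣p∪q∣+∣p∩q∣≡∣p∣+∣q∣ p q)) (sym (+-suc ∣ p ∣ ∣ q ∣))
∣p∪q∣+∣p∩q∣≡∣p∣+∣q∣ (inside  ∷ p) (outside ∷ q) = cong suc (∣p∪q∣+∣p∩q∣≡∣p∣+∣q∣ p q)
∣p∪q∣+∣p∩q∣≡∣p∣+∣q∣ (inside  ∷ p) (inside  ∷ q) = cong suc (begin
  ∣ p ∪ q ∣ + suc ∣ p ∩ q ∣ ≡⟨ +-suc ∣ p ∪ q ∣ ∣ p ∩ q ∣ ⟩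
  suc (∣ p ∪ q ∣ + ∣ p ∩ q ∣) ≡⟨ cong suc (∣p∪q∣+∣p∩q∣≡∣p∣+∣q∣ p q) ⟩
  suc (∣ p ∣ + ∣ q ∣)         ≡⟨ +-suc ∣ p ∣ ∣ q ∣ ⟨
  ∣ p ∣ + suc ∣ q ∣           ∎)
  where open ≡-Reasoning

∣p∪q∣≤∣p∣+∣q∣ : (p q : Subset n) → ∣ p ∪ q ∣ ≤ ∣ p ∣ + ∣ q ∣
∣p∪q∣≤∣p∣+∣q∣ p q = subst (∣ p ∪ q ∣ ≤_) (∣p∪q∣+∣p∩q∣≡∣p∣+∣q∣ p q) (m≤m+n _ _)

Empty⇒∣p∣≡0 : {p : Subset n} → Empty p → ∣ p ∣ ≡ 0
Empty⇒∣p∣≡0 {n} p-empty = trans (cong ∣_∣ (Empty-unique p-empty)) (∣⊥∣≡0 n)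

∣p∣>0⇒Nonempty : (p : Subset n) → 0 < ∣ p ∣ → Nonempty p
∣p∣>0⇒Nonempty p ∣p∣>0 with nonempty? p
... | yes p-nonempty = p-nonempty
... | no  p-empty    = contradiction (sym (Empty⇒∣p∣≡0 p-empty)) (<⇒≢ ∣p∣>0)

Empty[p∩q]⇒∣p∪q∣≡∣p∣+∣q∣ : (p q : Subset n) → Empty (p ∩ q) → ∣ p ∪ q ∣ ≡ ∣ p ∣ + ∣ q ∣
Empty[p∩q]⇒∣p∪q∣≡∣p∣+∣q∣ p q p∩q-empty = begin
  ∣ p ∪ q ∣             ≡⟨ +-identityʳ _ ⟨
  ∣ p ∪ q ∣ + 0         ≡⟨ cong (∣ p ∪ q ∣ +_) (Empty⇒∣p∣≡0 p∩q-empty) ⟨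
  ∣ p ∪ q ∣ + ∣ p ∩ q ∣ ≡⟨ ∣p∪q∣+∣p∩q∣≡∣p∣+∣q∣ p q ⟩
  ∣ p ∣ + ∣ q ∣         ∎
  where open ≡-Reasoning

p⊆q⇒∣p∣+∣q─p∣≡∣q∣ : {p q : Subset n} → p ⊆ q → ∣ p ∣ + ∣ q ─ p ∣ ≡ ∣ q ∣
p⊆q⇒∣p∣+∣q─p∣≡∣q∣ {p = []}          {[]}          _   = refl
p⊆q⇒∣p∣+∣q─p∣≡∣q∣ {p = outside ∷ p} {outside ∷ q} p⊆q = p⊆q⇒∣p∣+∣q─p∣≡∣q∣ (drop-∷-⊆ p⊆q)
p⊆q⇒∣p∣+∣q─p∣≡∣q∣ {p = outside ∷ p} {inside  ∷ q} p⊆q =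
  trans (+-suc ∣ p ∣ ∣ q ─ p ∣) (cong suc (p⊆q⇒∣p∣+∣q─p∣≡∣q∣ (drop-∷-⊆ p⊆q)))
p⊆q⇒∣p∣+∣q─p∣≡∣q∣ {p = inside  ∷ p} {outside ∷ q} p⊆q = contradiction (p⊆q here) λ ()
p⊆q⇒∣p∣+∣q─p∣≡∣q∣ {p = inside  ∷ p} {inside  ∷ q} p⊆q = cong suc (p⊆q⇒∣p∣+∣q─p∣≡∣q∣ (drop-∷-⊆ p⊆q))

p⊆q∧0<∣p∣⇒∣q─p∣<∣q∣ : {p q : Subset n} → p ⊆ q → 0 < ∣ p ∣ → ∣ q ─ p ∣ < ∣ q ∣
p⊆q∧0<∣p∣⇒∣q─p∣<∣q∣ {p = p} {q} p⊆q 0<∣p∣ =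
  subst (∣ q ─ p ∣ <_) (p⊆q⇒∣p∣+∣q─p∣≡∣q∣ p⊆q) (m<n+m ∣ q ─ p ∣ 0<∣p∣)

x∈p⇒1+∣p-x∣≡∣p∣ : ∀ {x} {p : Subset n} → x ∈ p → suc ∣ p - x ∣ ≡ ∣ p ∣
x∈p⇒1+∣p-x∣≡∣p∣ {x = x} {p} x∈p =
  trans (cong (_+ ∣ p - x ∣) (sym (∣⁅x⁆∣≡1 x))) (p⊆q⇒∣p∣+∣q─p∣≡∣q∣ (x∈p⇒⁅x⁆⊆p x∈p))

x∉p⇒∣p∪⁅x⁆∣≡1+∣p∣ : ∀ {x} (p : Subset n) → x ∉ p → ∣ p ∪ ⁅ x ⁆ ∣ ≡ suc ∣ p ∣
x∉p⇒∣p∪⁅x⁆∣≡1+∣p∣ {x = zero}  (outside ∷ p) _   = cong (suc ∘ ∣_∣) (∪-identityʳ p)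
x∉p⇒∣p∪⁅x⁆∣≡1+∣p∣ {x = zero}  (inside  ∷ p) x∉p = contradiction here x∉p
x∉p⇒∣p∪⁅x⁆∣≡1+∣p∣ {x = suc x} (outside ∷ p) x∉p = x∉p⇒∣p∪⁅x⁆∣≡1+∣p∣ p (x∉p ∘ there)
x∉p⇒∣p∪⁅x⁆∣≡1+∣p∣ {x = suc x} (inside  ∷ p) x∉p = cong suc (x∉p⇒∣p∪⁅x⁆∣≡1+∣p∣ p (x∉p ∘ there))

p⊆q∧∣q∣≤∣p∣⇒q⊆p : {p q : Subset n} → p ⊆ q → ∣ q ∣ ≤ ∣ p ∣ → q ⊆ p
p⊆q∧∣q∣≤∣p∣⇒q⊆p p⊆q ∣q∣≤∣p∣ = p⊆q∧p⊄q⇒q⊆p p⊆q (λ p⊂q → <⇒≱ (p⊂q⇒∣p∣<∣q∣ p⊂q) ∣q∣≤∣p∣)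

injection⇒∣p∣≤∣q∣ : ∀ {m} {p : Subset n} {q : Subset m} (f : ∀ x → x ∈ p → Fin m) →
  (∀ x (x∈p : x ∈ p) → f x x∈p ∈ q) →
  (∀ x y (x∈p : x ∈ p) (y∈p : y ∈ p) → f x x∈p ≡ f y y∈p → x ≡ y) →
  ∣ p ∣ ≤ ∣ q ∣
injection⇒∣p∣≤∣q∣ {p = p} = go (⊂-wellFounded p)
  where
  go : ∀ {m} {p} {q : Subset m} → Acc _⊂_ p → (f : ∀ x → x ∈ p → Fin m) →
       (∀ x x∈p → f x x∈p ∈ q) → (∀ x y x∈p y∈p → f x x∈p ≡ f y y∈p → x ≡ y) → ∣ p ∣ ≤ ∣ q ∣
  go {p = p} {q} (acc smaller) f f∈q f-inj with nonempty? p
  ... | no  p-empty    = subst (_≤ ∣ q ∣) (sym (Empty⇒∣p∣≡0 p-empty)) z≤n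
  ... | yes (x , x∈p) = begin
    ∣ p ∣                  ≡⟨ x∈p⇒1+∣p-x∣≡∣p∣ x∈p ⟨
    suc ∣ p - x ∣          ≤⟨ s≤s (go (smaller (x∈p⇒p-x⊂p x∈p)) f′ f′∈q-fx f′-inj) ⟩
    suc ∣ q - f x x∈p ∣    ≡⟨ x∈p⇒1+∣p-x∣≡∣p∣ (f∈q x x∈p) ⟩
    ∣ q ∣                  ∎
    where
    open ≤-Reasoning
    p-x⊆p : p - x ⊆ p
    p-x⊆p = p─q⊆p p ⁅ x ⁆
    f′ : ∀ y → y ∈ p - x → Fin _
    f′ y y∈p-x = f y (p-x⊆p y∈p-x)
    f′∈q-fx : ∀ y y∈p-x → f′ y y∈p-x ∈ q - f x x∈p
    f′∈q-fx y y∈p-x = x∈p∧x≢y⇒x∈p-y (f∈q y (p-x⊆p y∈p-x))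
      (λ fy≡fx → x∉⁅y⁆⇒x≢y (x∈p─q⇒x∉q p ⁅ x ⁆ y∈p-x) (f-inj y x _ x∈p fy≡fx))
    f′-inj : ∀ y z y∈p-x z∈p-x → f′ y y∈p-x ≡ f′ z z∈p-x → y ≡ z
    f′-inj y z y∈p-x z∈p-x = f-inj y z (p-x⊆p y∈p-x) (p-x⊆p z∈p-x)

Minimal : (Subset n → Set) → Subset n → Set
Minimal P V = P V × (∀ {Z} → P Z → Z ⊆ V → V ⊆ Z)

Maximal : (Subset n → Set) → Subset n → Set
Maximal P V = P V × (∀ {Z} → P Z → V ⊆ Z → Z ⊆ V)

minimal : {P : Subset n → Set} → Decidable P → ∀ {W} → P W → ∃ (Minimal P)
minimal {P = P} P? {W} = go (⊂-wellFounded W)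
  where
  go : ∀ {W} → Acc _⊂_ W → P W → ∃ (Minimal P)
  go {W} (acc smaller) PW with anySubset? (λ Z → P? Z ×-dec Z ⊂? W)
  ... | yes (Z , PZ , Z⊂W) = go (smaller Z⊂W) PZ
  ... | no  ∄Z⊂W = W , PW , λ PZ Z⊆W → p⊆q∧p⊄q⇒q⊆p Z⊆W (λ Z⊂W → ∄Z⊂W (_ , PZ , Z⊂W))

maximal : {P : Subset n → Set} → Decidable P → ∀ {W} → P W → ∃ λ V → W ⊆ V × Maximal P V
maximal {P = P} P? {W} = go ⊆-refl (⊃-wellFounded W)
  where
  go : ∀ {V} → W ⊆ V → Acc _⊃_ V → P V → ∃ λ V → W ⊆ V × Maximal P V
  go {V} W⊆V (acc larger) PV with anySubset? (λ Z → P? Z ×-dec V ⊂? Z)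
  ... | yes (Z , PZ , V⊂Z) = go (⊆-trans W⊆V (p⊂q⇒p⊆q V⊂Z)) (larger V⊂Z) PZ
  ... | no  ∄V⊂Z = V , W⊆V , PV , λ PZ V⊆Z → p⊆q∧p⊄q⇒q⊆p V⊆Z (λ V⊂Z → ∄V⊂Z (_ , PZ , V⊂Z))

countSubsets : {P : Subset n → Set} → Decidable P → ℕ
countSubsets {n = zero}  P? with P? []
... | yes _ = 1
... | no  _ = 0
countSubsets {n = suc n} P? = countSubsets (P? ∘ (inside ∷_)) + countSubsets (P? ∘ (outside ∷_))

countSubsets-mono : {P Q : Subset n → Set} (P? : Decidable P) (Q? : Decidable Q) →
                    (∀ {X} → P X → Q X) → countSubsets P? ≤ countSubsets Q?
countSubsets-mono {n = zero} P? Q? P⇒Q with P? [] | Q? []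
... | yes _  | yes _   = ≤-refl
... | yes P[] | no ¬Q[] = contradiction (P⇒Q P[]) ¬Q[]
... | no _   | _       = z≤n
countSubsets-mono {n = suc n} P? Q? P⇒Q =
  +-mono-≤ (countSubsets-mono (P? ∘ (inside ∷_)) (Q? ∘ (inside ∷_)) P⇒Q)
           (countSubsets-mono (P? ∘ (outside ∷_)) (Q? ∘ (outside ∷_)) P⇒Q)

countSubsets-< : {P Q : Subset n → Set} (P? : Decidable P) (Q? : Decidable Q) →
                 (∀ {X} → P X → Q X) → ∀ {W} → Q W → ¬ P W → countSubsets P? < countSubsets Q?
countSubsets-< {n = zero} P? Q? P⇒Q {[]} Q[] ¬P[] with P? [] | Q? []
... | yes P[] | _       = contradiction P[] ¬P[]
... | no _    | yes _   = s≤s z≤n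
... | no _    | no ¬Q[] = contradiction Q[] ¬Q[]
countSubsets-< {n = suc n} P? Q? P⇒Q {inside ∷ W} QW ¬PW =
  +-mono-<-≤ (countSubsets-< (P? ∘ (inside ∷_)) (Q? ∘ (inside ∷_)) P⇒Q QW ¬PW)
             (countSubsets-mono (P? ∘ (outside ∷_)) (Q? ∘ (outside ∷_)) P⇒Q)
countSubsets-< {n = suc n} P? Q? P⇒Q {outside ∷ W} QW ¬PW =
  +-mono-≤-< (countSubsets-mono (P? ∘ (inside ∷_)) (Q? ∘ (inside ∷_)) P⇒Q)
             (countSubsets-< (P? ∘ (outside ∷_)) (Q? ∘ (outside ∷_)) P⇒Q QW ¬PW)

module Hall {n r : ℕ} (A : Fin r → Subset n) where

  N : Subset n → Subset r
  N J = tabulate (λ i → does (nonempty? (A i ∩ J)))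

  ∈N⁺ : ∀ {J i e} → e ∈ A i → e ∈ J → i ∈ N J
  ∈N⁺ {J} e∈Ai e∈J = ∈-tabulate⁺ (λ i → nonempty? (A i ∩ J)) (_ , x∈p∩q⁺ (e∈Ai , e∈J))

  ∈N⁻ : ∀ {J i} → i ∈ N J → ∃ λ e → e ∈ A i × e ∈ J
  ∈N⁻ {J} {i} i∈NJ with ∈-tabulate⁻ (λ i → nonempty? (A i ∩ J)) i∈NJ
  ... | e , e∈Ai∩J = e , x∈p∩q⁻ (A i) J e∈Ai∩J

  record Matching (S : Subset r) (I : Subset n) : Set where
    field
      φ           : ∀ e → e ∈ I → Fin r
      φ∈S         : ∀ e (e∈I : e ∈ I) → φ e e∈I ∈ S
      ∈Aφ         : ∀ e (e∈I : e ∈ I) → e ∈ A (φ e e∈I)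
      φ-injective : ∀ e e′ (e∈I : e ∈ I) (e′∈I : e′ ∈ I) → φ e e∈I ≡ φ e′ e′∈I → e ≡ e′

  HallCondition : Subset r → Subset n → Set
  HallCondition S I = ∀ {J} → J ⊆ I → ∣ J ∣ ≤ ∣ S ∩ N J ∣

  matching-mono : ∀ {S S′ I I′} → S ⊆ S′ → I′ ⊆ I → Matching S I → Matching S′ I′
  matching-mono S⊆S′ I′⊆I m = record
    { φ           = λ e e∈I′ → φ e (I′⊆I e∈I′)
    ; φ∈S         = λ e e∈I′ → S⊆S′ (φ∈S e (I′⊆I e∈I′))
    ; ∈Aφ         = λ e e∈I′ → ∈Aφ e (I′⊆I e∈I′)
    ; φ-injective = λ e e′ e∈I′ e′∈I′ → φ-injective e e′ (I′⊆I e∈I′) (I′⊆I e′∈I′)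
    }
    where open Matching m

  matching-⊆N : ∀ {S J} → Matching S J → Matching (S ∩ N J) J
  matching-⊆N m = record
    { φ           = φ
    ; φ∈S         = λ e e∈J → x∈p∩q⁺ (φ∈S e e∈J , ∈N⁺ (∈Aφ e e∈J) e∈J)
    ; ∈Aφ         = ∈Aφ
    ; φ-injective = φ-injective
    }
    where open Matching m

  empty-matching : ∀ {S I} → Empty I → Matching S I
  empty-matching I-empty = record
    { φ           = λ e e∈I → ⊥-elim (I-empty (e , e∈I))
    ; φ∈S         = λ e e∈I → ⊥-elim (I-empty (e , e∈I))
    ; ∈Aφ         = λ e e∈I → ⊥-elim (I-empty (e , e∈I))
    ; φ-injective = λ e _ e∈I _ _ → ⊥-elim (I-empty (e , e∈I))
    }

  singleton-matching : ∀ {x i} → x ∈ A i → Matching ⁅ i ⁆ ⁅ x ⁆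
  singleton-matching {x} {i} x∈Ai = record
    { φ           = λ _ _ → i
    ; φ∈S         = λ _ _ → x∈⁅x⁆ i
    ; ∈Aφ         = λ e e∈⁅x⁆ → subst (_∈ A i) (sym (x∈⁅y⁆⇒x≡y x e∈⁅x⁆)) x∈Ai
    ; φ-injective = λ e e′ e∈⁅x⁆ e′∈⁅x⁆ _ → trans (x∈⁅y⁆⇒x≡y x e∈⁅x⁆) (sym (x∈⁅y⁆⇒x≡y x e′∈⁅x⁆))
    }

  matching-∪ : ∀ {S T J K} → (∀ {i} → i ∈ S → i ∉ T) →
               Matching S J → Matching T K → Matching (S ∪ T) (J ∪ K)
  matching-∪ {S} {T} {J} {K} S∩T-empty m₁ m₂ =
    record { φ = φ ; φ∈S = φ∈S∪T ; ∈Aφ = ∈Aφ ; φ-injective = φ-injective }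
    where
    module M₁ = Matching m₁
    module M₂ = Matching m₂
    φ′ : ∀ e → e ∈ J ∪ K → Dec (e ∈ J) → Fin r
    φ′ e _    (yes e∈J) = M₁.φ e e∈J
    φ′ e e∈JK (no  e∉J) = M₂.φ e (x∈p∪q∧x∉p⇒x∈q e∈JK e∉J)
    φ : ∀ e → e ∈ J ∪ K → Fin r
    φ e e∈JK = φ′ e e∈JK (e ∈? J)
    φ′∈S∪T : ∀ e e∈JK e∈J? → φ′ e e∈JK e∈J? ∈ S ∪ T
    φ′∈S∪T e _ (yes e∈J) = x∈p∪q⁺ (inj₁ (M₁.φ∈S e e∈J))
    φ′∈S∪T e _ (no  _)   = x∈p∪q⁺ (inj₂ (M₂.φ∈S e _))
    φ∈S∪T : ∀ e e∈JK → φ e e∈JK ∈ S ∪ T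
    φ∈S∪T e e∈JK = φ′∈S∪T e e∈JK (e ∈? J)
    ∈Aφ′ : ∀ e e∈JK e∈J? → e ∈ A (φ′ e e∈JK e∈J?)
    ∈Aφ′ e _ (yes e∈J) = M₁.∈Aφ e e∈J
    ∈Aφ′ e _ (no  _)   = M₂.∈Aφ e _
    ∈Aφ : ∀ e e∈JK → e ∈ A (φ e e∈JK)
    ∈Aφ e e∈JK = ∈Aφ′ e e∈JK (e ∈? J)
    φ′-injective : ∀ e e′ e∈JK e′∈JK e∈J? e′∈J? → φ′ e e∈JK e∈J? ≡ φ′ e′ e′∈JK e′∈J? → e ≡ e′
    φ′-injective e e′ _ _ (yes e∈J) (yes e′∈J) = M₁.φ-injective e e′ e∈J e′∈J
    φ′-injective e e′ _ _ (no  _)   (no  _)    = M₂.φ-injective e e′ _ _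
    φ′-injective e e′ _ _ (yes e∈J) (no  _)    φe≡φe′ =
      contradiction (subst (_∈ T) (sym φe≡φe′) (M₂.φ∈S e′ _)) (S∩T-empty (M₁.φ∈S e e∈J))
    φ′-injective e e′ _ _ (no  _)   (yes e′∈J) φe≡φe′ =
      contradiction (subst (_∈ T) φe≡φe′ (M₂.φ∈S e _)) (S∩T-empty (M₁.φ∈S e′ e′∈J))
    φ-injective : ∀ e e′ e∈JK e′∈JK → φ e e∈JK ≡ φ e′ e′∈JK → e ≡ e′
    φ-injective e e′ e∈JK e′∈JK = φ′-injective e e′ e∈JK e′∈JK (e ∈? J) (e′ ∈? J)

  matching⇒∣I∣≤∣S∣ : ∀ {S I} → Matching S I → ∣ I ∣ ≤ ∣ S ∣
  matching⇒∣I∣≤∣S∣ m = injection⇒∣p∣≤∣q∣ φ φ∈S φ-injective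
    where open Matching m

  matching⇒hallCondition : ∀ {S I} → Matching S I → HallCondition S I
  matching⇒hallCondition m J⊆I = matching⇒∣I∣≤∣S∣ (matching-⊆N (matching-mono ⊆-refl J⊆I m))

  hallCondition-─critical : ∀ {S I J} → J ⊆ I → ∣ S ∩ N J ∣ ≤ ∣ J ∣ →
                            HallCondition S I → HallCondition (S ─ N J) (I ─ J)
  hallCondition-─critical {S} {I} {J} J⊆I critical cond {K} K⊆I─J =
    +-cancelʳ-≤ ∣ J ∣ (∣ K ∣) (∣ (S ─ N J) ∩ N K ∣) (begin
      ∣ K ∣ + ∣ J ∣                       ≡⟨ Empty[p∩q]⇒∣p∪q∣≡∣p∣+∣q∣ K J K∩J-empty ⟨
      ∣ K ∪ J ∣                           ≤⟨ cond (∪-least (p─q⊆p I J ∘ K⊆I─J) J⊆I) ⟩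
      ∣ S ∩ N (K ∪ J) ∣                   ≤⟨ p⊆q⇒∣p∣≤∣q∣ split ⟩
      ∣ (S ─ N J) ∩ N K ∪ S ∩ N J ∣       ≤⟨ ∣p∪q∣≤∣p∣+∣q∣ ((S ─ N J) ∩ N K) (S ∩ N J) ⟩
      ∣ (S ─ N J) ∩ N K ∣ + ∣ S ∩ N J ∣   ≤⟨ +-monoʳ-≤ ∣ (S ─ N J) ∩ N K ∣ critical ⟩
      ∣ (S ─ N J) ∩ N K ∣ + ∣ J ∣         ∎)
    where
    open ≤-Reasoning
    K∩J-empty : Empty (K ∩ J)
    K∩J-empty (e , e∈K∩J) = let e∈K , e∈J = x∈p∩q⁻ K J e∈K∩J in x∈p─q⇒x∉q I J (K⊆I─J e∈K) e∈J
    split : S ∩ N (K ∪ J) ⊆ (S ─ N J) ∩ N K ∪ S ∩ N J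
    split {i} i∈S∩N with x∈p∩q⁻ S _ i∈S∩N | i ∈? N J
    ... | i∈S , _     | yes i∈NJ = x∈p∪q⁺ (inj₂ (x∈p∩q⁺ (i∈S , i∈NJ)))
    ... | i∈S , i∈N   | no  i∉NJ with ∈N⁻ i∈N
    ...   | e , e∈Ai , e∈K∪J with x∈p∪q⁻ K J e∈K∪J
    ...     | inj₁ e∈K = x∈p∪q⁺ (inj₁ (x∈p∩q⁺ (x∈p∧x∉q⇒x∈p─q i∈S i∉NJ , ∈N⁺ e∈Ai e∈K)))
    ...     | inj₂ e∈J = contradiction (∈N⁺ e∈Ai e∈J) i∉NJ

  hallCondition-surplus : ∀ {S I x i} → x ∈ I →
    (∀ {K} → K ⊆ I → 0 < ∣ K ∣ → ∣ K ∣ < ∣ I ∣ → ∣ K ∣ < ∣ S ∩ N K ∣) →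
    HallCondition (S - i) (I - x)
  hallCondition-surplus {S} {I} {x} {i} x∈I surplus {K} K⊆I-x with 0 <? ∣ K ∣
  ... | no  ∣K∣≯0 = ≤-trans (≮⇒≥ ∣K∣≯0) z≤n
  ... | yes ∣K∣>0 = ≤-pred (begin
    suc ∣ K ∣                       ≤⟨ surplus (p─q⊆p I ⁅ x ⁆ ∘ K⊆I-x) ∣K∣>0 ∣K∣<∣I∣ ⟩
    ∣ S ∩ N K ∣                     ≤⟨ p⊆q⇒∣p∣≤∣q∣ split ⟩
    ∣ (S - i) ∩ N K ∪ ⁅ i ⁆ ∣       ≤⟨ ∣p∪q∣≤∣p∣+∣q∣ ((S - i) ∩ N K) ⁅ i ⁆ ⟩
    ∣ (S - i) ∩ N K ∣ + ∣ ⁅ i ⁆ ∣   ≡⟨ cong (∣ (S - i) ∩ N K ∣ +_) (∣⁅x⁆∣≡1 i) ⟩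
    ∣ (S - i) ∩ N K ∣ + 1           ≡⟨ +-comm ∣ (S - i) ∩ N K ∣ 1 ⟩
    suc ∣ (S - i) ∩ N K ∣           ∎)
    where
    open ≤-Reasoning
    ∣K∣<∣I∣ : ∣ K ∣ < ∣ I ∣
    ∣K∣<∣I∣ = ≤-<-trans (p⊆q⇒∣p∣≤∣q∣ K⊆I-x) (x∈p⇒∣p-x∣<∣p∣ x∈I)
    split : S ∩ N K ⊆ (S - i) ∩ N K ∪ ⁅ i ⁆
    split {j} j∈S∩NK with j ≟ᶠ i
    ... | yes refl = x∈p∪q⁺ (inj₂ (x∈⁅x⁆ j))
    ... | no  j≢i  = let j∈S , j∈NK = x∈p∩q⁻ S (N K) j∈S∩NK
                     in x∈p∪q⁺ (inj₁ (x∈p∩q⁺ (x∈p∧x≢y⇒x∈p-y j∈S j≢i , j∈NK)))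

  combine-critical : ∀ {S I J} → J ⊆ I → Matching S J → Matching (S ─ N J) (I ─ J) → Matching S I
  combine-critical {S} {I} {J} J⊆I m₁ m₂ =
    matching-mono (∪-least (p∩q⊆p S (N J)) (p─q⊆p S (N J))) (p⊆q∪[p─q] I J)
      (matching-∪ disjoint (matching-⊆N m₁) m₂)
    where
    disjoint : ∀ {i} → i ∈ S ∩ N J → i ∉ S ─ N J
    disjoint i∈S∩NJ i∈S─NJ = x∈p─q⇒x∉q S (N J) i∈S─NJ (proj₂ (x∈p∩q⁻ S (N J) i∈S∩NJ))

  combine-surplus : ∀ {S I x i} → x ∈ A i → x ∈ I → i ∈ S → Matching (S - i) (I - x) → Matching S I
  combine-surplus {S} {I} {x} {i} x∈Ai x∈I i∈S m =
    matching-mono (∪-least (x∈p⇒⁅x⁆⊆p i∈S) (p─q⊆p S ⁅ i ⁆)) (p⊆q∪[p─q] I ⁅ x ⁆)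
      (matching-∪ disjoint (singleton-matching x∈Ai) m)
    where
    disjoint : ∀ {j} → j ∈ ⁅ i ⁆ → j ∉ S - i
    disjoint j∈⁅i⁆ j∈S-i = x∈p─q⇒x∉q S ⁅ i ⁆ j∈S-i j∈⁅i⁆

  ∈N⁅x⁆⇒x∈A : ∀ {x i} → i ∈ N ⁅ x ⁆ → x ∈ A i
  ∈N⁅x⁆⇒x∈A {x} {i} i∈N⁅x⁆ with ∈N⁻ i∈N⁅x⁆
  ... | e , e∈Ai , e∈⁅x⁆ = subst (_∈ A i) (x∈⁅y⁆⇒x≡y x e∈⁅x⁆) e∈Ai

  -- Halmos–Vaughan: split I along a critical set J (0 < |J| < |I|, |S ∩ N J| ≤ |J|) if there is
  -- one; otherwise every such J has a surplus, so any x ∈ I can take any admissible index.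
  hall : ∀ {S I} → HallCondition S I → Matching S I
  hall {S} {I} = go S I (<-wellFounded ∣ I ∣)
    where
    go : ∀ S I → Acc _<_ ∣ I ∣ → HallCondition S I → Matching S I
    go S I (acc smaller) cond
      with anySubset? (λ J → J ⊆? I ×-dec 0 <? ∣ J ∣ ×-dec ∣ J ∣ <? ∣ I ∣ ×-dec ∣ S ∩ N J ∣ ≤? ∣ J ∣)
    ... | yes (J , J⊆I , ∣J∣>0 , ∣J∣<∣I∣ , critical) =
      combine-critical J⊆I
        (go S J (smaller ∣J∣<∣I∣) (λ K⊆J → cond (⊆-trans K⊆J J⊆I)))
        (go (S ─ N J) (I ─ J) (smaller (p⊆q∧0<∣p∣⇒∣q─p∣<∣q∣ J⊆I ∣J∣>0))
            (hallCondition-─critical {S} J⊆I critical cond))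
    ... | no ∄critical with nonempty? I
    ...   | no  I-empty    = empty-matching I-empty
    ...   | yes (x , x∈I) with ∣p∣>0⇒Nonempty (S ∩ N ⁅ x ⁆)
                                 (subst (_≤ ∣ S ∩ N ⁅ x ⁆ ∣) (∣⁅x⁆∣≡1 x) (cond (x∈p⇒⁅x⁆⊆p x∈I)))
    ...     | i , i∈S∩N⁅x⁆ =
      let i∈S , i∈N⁅x⁆ = x∈p∩q⁻ S (N ⁅ x ⁆) i∈S∩N⁅x⁆ in
      combine-surplus (∈N⁅x⁆⇒x∈A i∈N⁅x⁆) x∈I i∈S
        (go (S - i) (I - x) (smaller (x∈p⇒∣p-x∣<∣p∣ x∈I))
            (hallCondition-surplus {S} {I} {x} {i} x∈I λ K⊆I ∣K∣>0 ∣K∣<∣I∣ →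
               ≰⇒> λ tight → ∄critical (_ , K⊆I , ∣K∣>0 , ∣K∣<∣I∣ , tight)))

  partialTransversal⇔hallCondition : ∀ {I} → IsPartialTransversal A I ⇔ (∀ {J} → J ⊆ I → ∣ J ∣ ≤ ∣ N J ∣)
  partialTransversal⇔hallCondition {I} = mk⇔ to from
    where
    to : IsPartialTransversal A I → ∀ {J} → J ⊆ I → ∣ J ∣ ≤ ∣ N J ∣
    to (φ , ∈Aφ , φ-injective) {J} J⊆I =
      subst (λ X → ∣ J ∣ ≤ ∣ X ∣) (∩-identityˡ (N J)) (matching⇒hallCondition m J⊆I)
      where
      m : Matching ⊤ I
      m = record { φ = φ ; φ∈S = λ _ _ → ∈⊤ ; ∈Aφ = ∈Aφ ; φ-injective = φ-injective }
    from : (∀ {J} → J ⊆ I → ∣ J ∣ ≤ ∣ N J ∣) → IsPartialTransversal A I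
    from cond = φ , ∈Aφ , φ-injective
      where
      open Matching (hall {⊤} λ {J} J⊆I → subst (λ X → ∣ J ∣ ≤ ∣ X ∣) (sym (∩-identityˡ (N J))) (cond J⊆I))

iverson : {P : Set} → Dec P → ℕ
iverson (yes _) = 1
iverson (no  _) = 0

count⊇ : Subset n → List (Subset n) → ℕ
count⊇ X []      = 0
count⊇ X (Z ∷ L) = iverson (X ⊆? Z) + count⊇ X L

count⊇-⊥ : (L : List (Subset n)) → count⊇ ⊥ L ≡ length L
count⊇-⊥ []      = refl
count⊇-⊥ (Z ∷ L) with ⊥ ⊆? Z
... | yes _   = cong suc (count⊇-⊥ L)
... | no  ⊥⊈Z = ⊥-elim (⊥⊈Z ⊥⊆)

count⊇-antitone : ∀ {X Y : Subset n} → X ⊆ Y → ∀ L → count⊇ Y L ≤ count⊇ X L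
count⊇-antitone         X⊆Y []      = z≤n
count⊇-antitone {X = X} {Y} X⊆Y (Z ∷ L) = +-mono-≤ step (count⊇-antitone X⊆Y L)
  where
  step : iverson (Y ⊆? Z) ≤ iverson (X ⊆? Z)
  step with Y ⊆? Z | X ⊆? Z
  ... | yes _   | yes _   = ≤-refl
  ... | yes Y⊆Z | no  X⊈Z = ⊥-elim (X⊈Z (⊆-trans X⊆Y Y⊆Z))
  ... | no  _   | _       = z≤n

count⊇-none : ∀ {X : Subset n} {L} → All (X ⊈_) L → count⊇ X L ≡ 0
count⊇-none []                              = refl
count⊇-none {X = X} {Z ∷ L} (X⊈Z ∷ X⊈L) with X ⊆? Z
... | yes X⊆Z = ⊥-elim (X⊈Z X⊆Z)
... | no  _   = count⊇-none X⊈L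

count⊇-++ : ∀ (X : Subset n) L L′ → count⊇ X (L ++ L′) ≡ count⊇ X L + count⊇ X L′
count⊇-++ X []      L′ = refl
count⊇-++ X (Z ∷ L) L′ =
  trans (cong (iverson (X ⊆? Z) +_) (count⊇-++ X L L′)) (sym (+-assoc (iverson (X ⊆? Z)) _ _))

count⊇-replicate-⊆ : ∀ {X W : Subset n} m → X ⊆ W → count⊇ X (replicate m W) ≡ m
count⊇-replicate-⊆         zero    _   = refl
count⊇-replicate-⊆ {X = X} {W} (suc m) X⊆W with X ⊆? W
... | yes _   = cong suc (count⊇-replicate-⊆ m X⊆W)
... | no  X⊈W = ⊥-elim (X⊈W X⊆W)

count⊇-replicate-⊈ : ∀ {X W : Subset n} m → X ⊈ W → count⊇ X (replicate m W) ≡ 0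
count⊇-replicate-⊈ m X⊈W = count⊇-none (replicate⁺ m X⊈W)

count⊇-∪ : ∀ {X W₁ W₂ : Subset n} {L} → All (λ Z → X ⊆ Z → W₁ ⊆ Z ⊎ W₂ ⊆ Z) L →
           count⊇ X L + count⊇ (W₁ ∪ W₂) L ≤ count⊇ W₁ L + count⊇ W₂ L
count⊇-∪ [] = z≤n
count⊇-∪ {X = X} {W₁} {W₂} {Z ∷ L} (cover ∷ covers) = begin
  (iX + count⊇ X L) + (iU + count⊇ (W₁ ∪ W₂) L)      ≡⟨ interchange iX _ iU _ ⟩
  (iX + iU) + (count⊇ X L + count⊇ (W₁ ∪ W₂) L)      ≤⟨ +-mono-≤ step (count⊇-∪ covers) ⟩
  (i₁ + i₂) + (count⊇ W₁ L + count⊇ W₂ L)            ≡⟨ interchange i₁ i₂ _ _ ⟩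
  (i₁ + count⊇ W₁ L) + (i₂ + count⊇ W₂ L)            ∎
  where
  open ≤-Reasoning
  iX iU i₁ i₂ : ℕ
  iX = iverson (X ⊆? Z)
  iU = iverson (W₁ ∪ W₂ ⊆? Z)
  i₁ = iverson (W₁ ⊆? Z)
  i₂ = iverson (W₂ ⊆? Z)
  step : iX + iU ≤ i₁ + i₂
  step with X ⊆? Z | W₁ ∪ W₂ ⊆? Z | W₁ ⊆? Z | W₂ ⊆? Z
  ... | _       | yes U⊆Z | no  W₁⊈Z | _        = ⊥-elim (W₁⊈Z (U⊆Z ∘ p⊆p∪q W₂))
  ... | _       | yes U⊆Z | yes _    | no  W₂⊈Z = ⊥-elim (W₂⊈Z (U⊆Z ∘ q⊆p∪q W₁ W₂))
  ... | yes _   | yes _   | yes _    | yes _    = ≤-refl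
  ... | no  _   | yes _   | yes _    | yes _    = s≤s z≤n
  ... | no  _   | no  _   | _        | _        = z≤n
  ... | yes _   | no  _   | yes _    | _        = s≤s z≤n
  ... | yes _   | no  _   | no  _    | yes _    = s≤s z≤n
  ... | yes X⊆Z | no  _   | no  W₁⊈Z | no  W₂⊈Z = ⊥-elim ([ W₁⊈Z , W₂⊈Z ]′ (cover X⊆Z))

∣N∣+count⊇≡length : ∀ (J : Subset n) L → ∣ Hall.N (λ i → ∁ (lookup L i)) J ∣ + count⊇ J L ≡ length L
∣N∣+count⊇≡length J []      = refl
∣N∣+count⊇≡length J (Z ∷ L) with nonempty? (∁ Z ∩ J) | J ⊆? Z
... | yes (e , e∈∁Z∩J) | yes J⊆Z =
  let e∈∁Z , e∈J = x∈p∩q⁻ (∁ Z) J e∈∁Z∩J in contradiction (J⊆Z e∈J) (x∈∁p⇒x∉p e∈∁Z)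
... | yes _ | no  _ = cong suc (∣N∣+count⊇≡length J L)
... | no  _ | yes _ = trans (+-suc _ _) (cong suc (∣N∣+count⊇≡length J L))
... | no  ∁Z∩J-empty | no J⊈Z = ⊥-elim (J⊈Z J⊆Z)
  where
  J⊆Z : J ⊆ Z
  J⊆Z {e} e∈J with e ∈? Z
  ... | yes e∈Z = e∈Z
  ... | no  e∉Z = contradiction (e , x∈p∩q⁺ (x∉p⇒x∈∁p e∉Z , e∈J)) ∁Z∩J-empty

infix 4 _∥_

_∥_ : Subset n → Subset n → Set
X ∥ Y = X ⊈ Y × Y ⊈ X

Width≤2 : (Subset n → Set) → Set
Width≤2 P = ∀ {X Y Z} → P X → P Y → P Z → ¬ (X ∥ Y × X ∥ Z × Y ∥ Z)

width≤2-⊆ : {P Q : Subset n → Set} → (∀ {X} → P X → Q X) → Width≤2 Q → Width≤2 P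
width≤2-⊆ P⇒Q width PX PY PZ = width (P⇒Q PX) (P⇒Q PY) (P⇒Q PZ)

∥-∁ : {X Y : Subset n} → X ∥ Y → ∁ X ∥ ∁ Y
∥-∁ (X⊈Y , Y⊈X) = Y⊈X ∘ ∁p⊆∁q⇒p⊇q , X⊈Y ∘ ∁p⊆∁q⇒p⊇q

width≤2⇒two-minimal-cover : {P : Subset n → Set} → Decidable P → Width≤2 P → ∀ {W} → P W →
  ∃₂ λ W₁ W₂ → P W₁ × P W₂ × (∀ {Z} → P Z → W₁ ⊆ Z ⊎ W₂ ⊆ Z)
width≤2⇒two-minimal-cover {P = P} P? width PW with minimal P? PW
... | W₁ , PW₁ , W₁-min with anySubset? (λ Z → P? Z ×-dec ¬? (W₁ ⊆? Z))
...   | no ∄Z = W₁ , W₁ , PW₁ , PW₁ , inj₁ ∘ W₁⊆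
  where
  W₁⊆ : ∀ {Z} → P Z → W₁ ⊆ Z
  W₁⊆ {Z} PZ with W₁ ⊆? Z
  ... | yes W₁⊆Z = W₁⊆Z
  ... | no  W₁⊈Z = contradiction (Z , PZ , W₁⊈Z) ∄Z
...   | yes (_ , P′Z₀) with minimal (λ Z → P? Z ×-dec ¬? (W₁ ⊆? Z)) P′Z₀
...     | W₂ , (PW₂ , W₁⊈W₂) , W₂-min = W₁ , W₂ , PW₁ , PW₂ , cover
  where
  cover : ∀ {Z} → P Z → W₁ ⊆ Z ⊎ W₂ ⊆ Z
  cover {Z} PZ with W₁ ⊆? Z | W₂ ⊆? Z
  ... | yes W₁⊆Z | _        = inj₁ W₁⊆Z
  ... | no  _    | yes W₂⊆Z = inj₂ W₂⊆Z
  ... | no  W₁⊈Z | no  W₂⊈Z = ⊥-elim (width PW₁ PW₂ PZ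
    ( (W₁⊈W₂ , λ W₂⊆W₁ → W₁⊈W₂ (W₁-min PW₂ W₂⊆W₁))
    , (W₁⊈Z  , λ Z⊆W₁  → W₁⊈Z  (W₁-min PZ Z⊆W₁))
    , (W₂⊈Z  , λ Z⊆W₂  → W₂⊈Z  (W₂-min (PZ , W₁⊈Z) Z⊆W₂))))

record RankFunction (n : ℕ) : Set where
  field
    rank            : Subset n → ℕ
    rank-bounded    : ∀ X → rank X ≤ ∣ X ∣
    rank-mono       : ∀ {X Y} → X ⊆ Y → rank X ≤ rank Y
    rank-submodular : ∀ X Y → rank (X ∪ Y) + rank (X ∩ Y) ≤ rank X + rank Y

Independent : RankFunction n → Subset n → Set
Independent ρ I = rank I ≡ ∣ I ∣
  where open RankFunction ρ

Flat : RankFunction n → Subset n → Set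
Flat ρ F = ∀ e → e ∉ F → rank F < rank (F ∪ ⁅ e ⁆)
  where open RankFunction ρ

Cyclic : RankFunction n → Subset n → Set
Cyclic ρ F = ∀ e → e ∈ F → rank F ≤ rank (F - e)
  where open RankFunction ρ

CyclicFlat : RankFunction n → Subset n → Set
CyclicFlat ρ F = Flat ρ F × Cyclic ρ F

cyclicFlat? : (ρ : RankFunction n) → Decidable (CyclicFlat ρ)
cyclicFlat? ρ F =
  all? (λ e → ¬? (e ∈? F) →-dec rank F <? rank (F ∪ ⁅ e ⁆)) ×-dec
  all? (λ e → e ∈? F →-dec rank F ≤? rank (F - e))
  where open RankFunction ρ

module RankFunctionProperties {n : ℕ} (ρ : RankFunction n) where
  open RankFunction ρ

  rank-⊥ : rank ⊥ ≡ 0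
  rank-⊥ = n≤0⇒n≡0 (≤-trans (rank-bounded ⊥) (≤-reflexive (∣⊥∣≡0 n)))

  rank-submodular-⊆ : ∀ {X Y C D} → C ⊆ X ∪ Y → D ⊆ X ∩ Y → rank C + rank D ≤ rank X + rank Y
  rank-submodular-⊆ {X} {Y} C⊆X∪Y D⊆X∩Y =
    ≤-trans (+-mono-≤ (rank-mono C⊆X∪Y) (rank-mono D⊆X∩Y)) (rank-submodular X Y)

  rank-subadditive : ∀ {X Y C} → C ⊆ X ∪ Y → rank C ≤ rank X + rank Y
  rank-subadditive {X} {Y} {C} C⊆X∪Y = begin
    rank C          ≡⟨ +-identityʳ (rank C) ⟨
    rank C + 0      ≡⟨ cong (rank C +_) rank-⊥ ⟨
    rank C + rank ⊥ ≤⟨ rank-submodular-⊆ C⊆X∪Y ⊥⊆ ⟩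
    rank X + rank Y ∎
    where open ≤-Reasoning

  independent-⊆ : ∀ {I J} → Independent ρ I → J ⊆ I → ∣ J ∣ ≤ rank J
  independent-⊆ {I} {J} rankI≡∣I∣ J⊆I = +-cancelʳ-≤ ∣ I ─ J ∣ ∣ J ∣ (rank J) (begin
    ∣ J ∣ + ∣ I ─ J ∣     ≡⟨ p⊆q⇒∣p∣+∣q─p∣≡∣q∣ J⊆I ⟩
    ∣ I ∣                 ≡⟨ rankI≡∣I∣ ⟨
    rank I                ≤⟨ rank-subadditive (p⊆q∪[p─q] I J) ⟩
    rank J + rank (I ─ J) ≤⟨ +-monoʳ-≤ (rank J) (rank-bounded (I ─ J)) ⟩
    rank J + ∣ I ─ J ∣    ∎)
    where open ≤-Reasoning

  dependent⇒cyclicDependentSubset : ∀ {I} → rank I < ∣ I ∣ →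
                                    ∃ λ C → C ⊆ I × rank C < ∣ C ∣ × Cyclic ρ C
  dependent⇒cyclicDependentSubset {I} rankI<∣I∣
    with minimal (λ C → C ⊆? I ×-dec rank C <? ∣ C ∣) (⊆-refl , rankI<∣I∣)
  ... | C , (C⊆I , rankC<∣C∣) , C-min = C , C⊆I , rankC<∣C∣ , C-cyclic
    where
    C-cyclic : Cyclic ρ C
    C-cyclic e e∈C = begin
      rank C       ≤⟨ ≤-pred (subst (rank C <_) (sym (x∈p⇒1+∣p-x∣≡∣p∣ e∈C)) rankC<∣C∣) ⟩
      ∣ C - e ∣    ≤⟨ ≮⇒≥ C-e-independent ⟩
      rank (C - e) ∎
      where
      open ≤-Reasoning
      C-e⊆C : C - e ⊆ C
      C-e⊆C = p─q⊆p C ⁅ e ⁆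
      C-e-independent : ¬ rank (C - e) < ∣ C - e ∣
      C-e-independent C-e-dependent =
        x∈p─q⇒x∉q C ⁅ e ⁆ (C-min (⊆-trans C-e⊆C C⊆I , C-e-dependent) C-e⊆C e∈C) (x∈⁅x⁆ e)

  rank-remove-cyclic : ∀ {W Y e} → Cyclic ρ W → e ∈ W → W ⊆ Y → rank Y ≤ rank (Y - e)
  rank-remove-cyclic {W} {Y} {e} W-cyclic e∈W W⊆Y =
    +-cancelʳ-≤ (rank (W - e)) (rank Y) (rank (Y - e)) (begin
      rank Y + rank (W - e)       ≤⟨ rank-submodular-⊆ Y⊆[Y-e]∪W W-e⊆[Y-e]∩W ⟩
      rank (Y - e) + rank W       ≤⟨ +-monoʳ-≤ (rank (Y - e)) (W-cyclic e e∈W) ⟩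
      rank (Y - e) + rank (W - e) ∎)
    where
    open ≤-Reasoning
    Y⊆[Y-e]∪W : Y ⊆ (Y - e) ∪ W
    Y⊆[Y-e]∪W {x} x∈Y with x ≟ᶠ e
    ... | yes refl = x∈p∪q⁺ (inj₂ e∈W)
    ... | no  x≢e  = x∈p∪q⁺ (inj₁ (x∈p∧x≢y⇒x∈p-y x∈Y x≢e))
    W-e⊆[Y-e]∩W : W - e ⊆ (Y - e) ∩ W
    W-e⊆[Y-e]∩W = ∩-greatest (p⊆q⇒p-x⊆q-x W⊆Y) (p─q⊆p W ⁅ e ⁆)

  cyclic-∪ : ∀ {X Y} → Cyclic ρ X → Cyclic ρ Y → Cyclic ρ (X ∪ Y)
  cyclic-∪ {X} {Y} X-cyclic Y-cyclic e e∈X∪Y with x∈p∪q⁻ X Y e∈X∪Y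
  ... | inj₁ e∈X = rank-remove-cyclic X-cyclic e∈X (p⊆p∪q Y)
  ... | inj₂ e∈Y = rank-remove-cyclic Y-cyclic e∈Y (q⊆p∪q X Y)

  cyclicFlat-hull : ∀ {X} → Cyclic ρ X → ∃ λ F → X ⊆ F × rank F ≤ rank X × CyclicFlat ρ F
  cyclicFlat-hull {X} X-cyclic with maximal (λ F → X ⊆? F ×-dec rank F ≤? rank X) (⊆-refl , ≤-refl)
  ... | F , _ , (X⊆F , rankF≤rankX) , F-max = F , X⊆F , rankF≤rankX , F-flat , F-cyclic
    where
    F-flat : Flat ρ F
    F-flat e e∉F = ≰⇒> λ rank[F+e]≤rankF →
      e∉F (F-max (⊆-trans X⊆F (p⊆p∪q ⁅ e ⁆) , ≤-trans rank[F+e]≤rankF rankF≤rankX) (p⊆p∪q ⁅ e ⁆)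
                 (q⊆p∪q F ⁅ e ⁆ (x∈⁅x⁆ e)))
    F-cyclic : Cyclic ρ F
    F-cyclic e e∈F with e ∈? X
    ... | yes e∈X = begin
      rank F       ≤⟨ rankF≤rankX ⟩
      rank X       ≤⟨ X-cyclic e e∈X ⟩
      rank (X - e) ≤⟨ rank-mono (p⊆q⇒p-x⊆q-x X⊆F) ⟩
      rank (F - e) ∎
      where open ≤-Reasoning
    ... | no e∉X = ≤-trans rankF≤rankX (rank-mono λ {x} x∈X →
      x∈p∧x≢y⇒x∈p-y (X⊆F x∈X) λ x≡e → e∉X (subst (_∈ X) x≡e x∈X))

module CyclicFlatPresentation {n : ℕ} (ρ : RankFunction n) (width : Width≤2 (CyclicFlat ρ)) where
  open RankFunction ρ
  open RankFunctionProperties ρ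

  Exact : (Subset n → Set) → List (Subset n) → Set
  Exact U L = ∀ {W} → U W → count⊇ W L + rank W ≡ rank ⊤

  UpClosed : (Subset n → Set) → Set
  UpClosed U = ∀ {W Z} → U W → CyclicFlat ρ Z → W ⊆ Z → U Z

  hull-∪ : ∀ {U W₁ W₂} → (∀ {W} → U W → CyclicFlat ρ W) → UpClosed U → U W₁ → U W₂ →
           ∃ λ V → U V × W₁ ∪ W₂ ⊆ V × rank V ≤ rank (W₁ ∪ W₂)
  hull-∪ {W₂ = W₂} U⊆CF up UW₁ UW₂ with cyclicFlat-hull (cyclic-∪ (proj₂ (U⊆CF UW₁)) (proj₂ (U⊆CF UW₂)))
  ... | V , W₁∪W₂⊆V , rankV≤ , V-cyclicFlat =
    V , up UW₁ V-cyclicFlat (W₁∪W₂⊆V ∘ p⊆p∪q W₂) , W₁∪W₂⊆V , rankV≤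

  two-cover-bound : ∀ {L X W₁ W₂ V} → All (λ Z → X ⊆ Z → W₁ ⊆ Z ⊎ W₂ ⊆ Z) L →
    X ⊆ W₁ → X ⊆ W₂ → W₁ ∪ W₂ ⊆ V → rank V ≤ rank (W₁ ∪ W₂) →
    count⊇ W₁ L + rank W₁ ≡ rank ⊤ → count⊇ W₂ L + rank W₂ ≡ rank ⊤ → count⊇ V L + rank V ≡ rank ⊤ →
    count⊇ X L + rank X ≤ rank ⊤
  two-cover-bound {L} {X} {W₁} {W₂} {V} covers X⊆W₁ X⊆W₂ W₁∪W₂⊆V rankV≤ exact₁ exact₂ exactV =
    +-cancelʳ-≤ (rank ⊤) (cX + rank X) (rank ⊤) (begin
      (cX + rank X) + rank ⊤                 ≡⟨ cong ((cX + rank X) +_) exactV ⟨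
      (cX + rank X) + (cV + rank V)          ≤⟨ +-monoʳ-≤ (cX + rank X)
                                                  (+-mono-≤ (count⊇-antitone W₁∪W₂⊆V L) rankV≤) ⟩
      (cX + rank X) + (cU + rank U)          ≡⟨ interchange cX (rank X) cU (rank U) ⟩
      (cX + cU) + (rank X + rank U)          ≤⟨ +-mono-≤ (count⊇-∪ covers)
                                                  (+-monoˡ-≤ (rank U) (rank-mono (∩-greatest X⊆W₁ X⊆W₂))) ⟩
      (c₁ + c₂) + (rank (W₁ ∩ W₂) + rank U)  ≡⟨ cong ((c₁ + c₂) +_) (+-comm (rank (W₁ ∩ W₂)) (rank U)) ⟩
      (c₁ + c₂) + (rank U + rank (W₁ ∩ W₂))  ≤⟨ +-monoʳ-≤ (c₁ + c₂) (rank-submodular W₁ W₂) ⟩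
      (c₁ + c₂) + (rank W₁ + rank W₂)        ≡⟨ interchange c₁ c₂ (rank W₁) (rank W₂) ⟩
      (c₁ + rank W₁) + (c₂ + rank W₂)        ≡⟨ cong₂ _+_ exact₁ exact₂ ⟩
      rank ⊤ + rank ⊤                        ∎)
    where
    open ≤-Reasoning
    U : Subset n
    U  = W₁ ∪ W₂
    cX cU cV c₁ c₂ : ℕ
    cX = count⊇ X L
    cU = count⊇ U L
    cV = count⊇ V L
    c₁ = count⊇ W₁ L
    c₂ = count⊇ W₂ L

  count⊇+rank≤rank⊤ : ∀ {U} → Decidable U → (∀ {W} → U W → CyclicFlat ρ W) → UpClosed U →
                      ∀ {L} → All U L → Exact U L → ∀ X → count⊇ X L + rank X ≤ rank ⊤
  count⊇+rank≤rank⊤ {U} U? U⊆CF up {L} all-U exact X with anySubset? (λ Z → U? Z ×-dec X ⊆? Z)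
  ... | no ∄Z = subst (_≤ rank ⊤) (cong (_+ rank X) (sym none)) (rank-mono ⊆⊤)
    where
    none : count⊇ X L ≡ 0
    none = count⊇-none (All.map (λ {Z} UZ (X⊆Z : X ⊆ Z) → ∄Z (Z , UZ , X⊆Z)) all-U)
  ... | yes (_ , UZ₀ , X⊆Z₀)
    with width≤2⇒two-minimal-cover (λ Z → U? Z ×-dec X ⊆? Z) (width≤2-⊆ (U⊆CF ∘ proj₁) width) (UZ₀ , X⊆Z₀)
  ... | W₁ , W₂ , (UW₁ , X⊆W₁) , (UW₂ , X⊆W₂) , cover with hull-∪ U⊆CF up UW₁ UW₂
  ... | V , UV , W₁∪W₂⊆V , rankV≤ =
    two-cover-bound (All.map (λ {Z} UZ (X⊆Z : X ⊆ Z) → cover (UZ , X⊆Z)) all-U)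
      X⊆W₁ X⊆W₂ W₁∪W₂⊆V rankV≤ (exact UW₁) (exact UW₂) (exact UV)

  Without : (Subset n → Set) → Subset n → Subset n → Set
  Without U W X = U X × X ≢ W

  without? : ∀ {U} → Decidable U → ∀ W → Decidable (Without U W)
  without? U? W X = U? X ×-dec ¬? (X ≟ₛ W)

  upClosed-without : ∀ {U W} → Minimal U W → UpClosed U → UpClosed (Without U W)
  upClosed-without (_ , W-min) up (UX , X≢W) Z-cyclicFlat X⊆Z =
    up UX Z-cyclicFlat X⊆Z , λ { refl → X≢W (⊆-antisym X⊆Z (W-min UX X⊆Z)) }

  exact-add-minimal : ∀ {U W L} m → Minimal U W → m + (count⊇ W L + rank W) ≡ rank ⊤ →
                      Exact (Without U W) L → Exact U (replicate m W ++ L)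
  exact-add-minimal {U} {W} {L} m (UW , W-min) m+bound≡rank⊤ exact {X} UX with X ≟ₛ W
  ... | yes refl = begin
    count⊇ W (replicate m W ++ L) + rank W           ≡⟨ cong (_+ rank W) (count⊇-++ W (replicate m W) L) ⟩
    (count⊇ W (replicate m W) + count⊇ W L) + rank W ≡⟨ cong (λ k → k + count⊇ W L + rank W)
                                                            (count⊇-replicate-⊆ m ⊆-refl) ⟩
    (m + count⊇ W L) + rank W                        ≡⟨ +-assoc m (count⊇ W L) (rank W) ⟩
    m + (count⊇ W L + rank W)                        ≡⟨ m+bound≡rank⊤ ⟩
    rank ⊤                                           ∎
    where open ≡-Reasoning
  ... | no X≢W = begin
    count⊇ X (replicate m W ++ L) + rank X           ≡⟨ cong (_+ rank X) (count⊇-++ X (replicate m W) L) ⟩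
    (count⊇ X (replicate m W) + count⊇ X L) + rank X ≡⟨ cong (λ k → k + count⊇ X L + rank X)
                                                            (count⊇-replicate-⊈ m X⊈W) ⟩
    count⊇ X L + rank X                              ≡⟨ exact (UX , X≢W) ⟩
    rank ⊤                                           ∎
    where
    open ≡-Reasoning
    X⊈W : X ⊈ W
    X⊈W X⊆W = X≢W (⊆-antisym X⊆W (W-min UX X⊆W))

  build : ∀ {U} (U? : Decidable U) → Acc _<_ (countSubsets U?) →
          (∀ {W} → U W → CyclicFlat ρ W) → UpClosed U → ∃ λ L → All U L × Exact U L
  build U? (acc smaller) U⊆CF up with anySubset? U?
  ... | no ∄W = [] , [] , λ UW → contradiction (_ , UW) ∄W
  ... | yes (_ , UW₀) with minimal U? UW₀
  ... | W , W-minimal@(UW , _)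
    with build (without? U? W) (smaller (countSubsets-< (without? U? W) U? proj₁ UW λ (_ , W≢W) → W≢W refl))
               (U⊆CF ∘ proj₁) (upClosed-without W-minimal up)
  ... | L , all-U′ , exact′ =
    replicate m W ++ L , ++⁺ (replicate⁺ m UW) (All.map proj₁ all-U′) ,
    exact-add-minimal m W-minimal (m∸n+n≡m bound) exact′
    where
    bound : count⊇ W L + rank W ≤ rank ⊤
    bound = count⊇+rank≤rank⊤ (without? U? W) (U⊆CF ∘ proj₁) (upClosed-without W-minimal up) all-U′ exact′ W
    m : ℕ
    m = rank ⊤ ∸ (count⊇ W L + rank W)

  private
    cyclicFlatList : ∃ λ L → All (CyclicFlat ρ) L × Exact (CyclicFlat ρ) L
    cyclicFlatList = build (cyclicFlat? ρ) (<-wellFounded _) id (λ _ Z-cyclicFlat _ → Z-cyclicFlat)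

    L : List (Subset n)
    L = proj₁ cyclicFlatList

    L-exact : Exact (CyclicFlat ρ) L
    L-exact = proj₂ (proj₂ cyclicFlatList)

    L-bound : ∀ X → count⊇ X L + rank X ≤ rank ⊤
    L-bound = count⊇+rank≤rank⊤ (cyclicFlat? ρ) id (λ _ Z-cyclicFlat _ → Z-cyclicFlat)
                (proj₁ (proj₂ cyclicFlatList)) L-exact

  open Hall (λ i → ∁ (lookup L i))

  count⊇⊥+rank⊥≡length : count⊇ ⊥ L + rank ⊥ ≡ length L
  count⊇⊥+rank⊥≡length = trans (cong₂ _+_ (count⊇-⊥ L) rank-⊥) (+-identityʳ (length L))

  length≡rank⊤ : length L ≡ rank ⊤
  length≡rank⊤ with cyclicFlat-hull {⊥} (λ e e∈⊥ → contradiction e∈⊥ ∉⊥)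
  ... | W₀ , _ , rankW₀≤rank⊥ , W₀-cyclicFlat = ≤-antisym
    (subst (_≤ rank ⊤) count⊇⊥+rank⊥≡length (L-bound ⊥))
    (begin
      rank ⊤                 ≡⟨ L-exact W₀-cyclicFlat ⟨
      count⊇ W₀ L + rank W₀  ≤⟨ +-mono-≤ (count⊇-antitone ⊥⊆ L) rankW₀≤rank⊥ ⟩
      count⊇ ⊥ L + rank ⊥    ≡⟨ count⊇⊥+rank⊥≡length ⟩
      length L               ∎)
    where open ≤-Reasoning

  independent⇔hallCondition : ∀ {I} → Independent ρ I ⇔ (∀ {J} → J ⊆ I → ∣ J ∣ ≤ ∣ N J ∣)
  independent⇔hallCondition {I} = mk⇔ to from
    where
    to : Independent ρ I → ∀ {J} → J ⊆ I → ∣ J ∣ ≤ ∣ N J ∣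
    to I-independent {J} J⊆I = +-cancelʳ-≤ (count⊇ J L) ∣ J ∣ ∣ N J ∣ (begin
      ∣ J ∣ + count⊇ J L    ≤⟨ +-monoˡ-≤ (count⊇ J L) (independent-⊆ I-independent J⊆I) ⟩
      rank J + count⊇ J L   ≡⟨ +-comm (rank J) (count⊇ J L) ⟩
      count⊇ J L + rank J   ≤⟨ L-bound J ⟩
      rank ⊤                ≡⟨ length≡rank⊤ ⟨
      length L              ≡⟨ ∣N∣+count⊇≡length J L ⟨
      ∣ N J ∣ + count⊇ J L  ∎)
      where open ≤-Reasoning
    from : (∀ {J} → J ⊆ I → ∣ J ∣ ≤ ∣ N J ∣) → Independent ρ I
    from hall = ≤-antisym (rank-bounded I) (≮⇒≥ λ rankI<∣I∣ →
      let J , J⊆I , rankJ<∣J∣ , J-cyclic = dependent⇒cyclicDependentSubset rankI<∣I∣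
          W , J⊆W , rankW≤rankJ , W-cyclicFlat = cyclicFlat-hull J-cyclic
      in <⇒≱ rankJ<∣J∣ (+-cancelʳ-≤ (count⊇ J L) ∣ J ∣ (rank J) (begin
        ∣ J ∣ + count⊇ J L    ≤⟨ +-monoˡ-≤ (count⊇ J L) (hall J⊆I) ⟩
        ∣ N J ∣ + count⊇ J L  ≡⟨ ∣N∣+count⊇≡length J L ⟩
        length L              ≡⟨ length≡rank⊤ ⟩
        rank ⊤                ≡⟨ L-exact W-cyclicFlat ⟨
        count⊇ W L + rank W   ≤⟨ +-mono-≤ (count⊇-antitone J⊆W L) rankW≤rankJ ⟩
        count⊇ J L + rank J   ≡⟨ +-comm (count⊇ J L) (rank J) ⟩
        rank J + count⊇ J L   ∎)))
      where open ≤-Reasoning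

  transversal : IsTransversalIndep (Independent ρ)
  transversal = length L , (λ i → ∁ (lookup L i)) , λ I →
    ⇔-sym partialTransversal⇔hallCondition ⇔-∘ independent⇔hallCondition

module Dual {n : ℕ} (ρ : RankFunction n) where
  open RankFunction ρ
  open RankFunctionProperties ρ
  open import Algebra.Lattice.Properties.BooleanAlgebra (∪-∩-booleanAlgebra n) using (deMorgan₁; deMorgan₂)

  rank⊤≤∣X∣+rank∁X : ∀ X → rank ⊤ ≤ ∣ X ∣ + rank (∁ X)
  rank⊤≤∣X∣+rank∁X X = begin
    rank ⊤              ≤⟨ rank-subadditive (⊆-reflexive (sym (p∪∁p≡⊤ X))) ⟩
    rank X + rank (∁ X) ≤⟨ +-monoˡ-≤ (rank (∁ X)) (rank-bounded X) ⟩
    ∣ X ∣ + rank (∁ X)  ∎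
    where open ≤-Reasoning

  -- The subtraction never truncates, by rank⊤≤∣X∣+rank∁X.
  rank* : Subset n → ℕ
  rank* X = ∣ X ∣ + rank (∁ X) ∸ rank ⊤

  rank*+rank⊤ : ∀ X → rank* X + rank ⊤ ≡ ∣ X ∣ + rank (∁ X)
  rank*+rank⊤ X = m∸n+n≡m (rank⊤≤∣X∣+rank∁X X)

  rank*-bounded : ∀ X → rank* X ≤ ∣ X ∣
  rank*-bounded X = +-cancelʳ-≤ (rank ⊤) (rank* X) ∣ X ∣ (begin
    rank* X + rank ⊤   ≡⟨ rank*+rank⊤ X ⟩
    ∣ X ∣ + rank (∁ X) ≤⟨ +-monoʳ-≤ ∣ X ∣ (rank-mono ⊆⊤) ⟩
    ∣ X ∣ + rank ⊤     ∎)
    where open ≤-Reasoning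

  rank*-mono : ∀ {X Y} → X ⊆ Y → rank* X ≤ rank* Y
  rank*-mono {X} {Y} X⊆Y = +-cancelʳ-≤ (rank ⊤) (rank* X) (rank* Y) (begin
    rank* X + rank ⊤                    ≡⟨ rank*+rank⊤ X ⟩
    ∣ X ∣ + rank (∁ X)                  ≤⟨ +-monoʳ-≤ ∣ X ∣ (rank-subadditive ∁X⊆[Y─X]∪∁Y) ⟩
    ∣ X ∣ + (rank (Y ─ X) + rank (∁ Y)) ≤⟨ +-monoʳ-≤ ∣ X ∣ (+-monoˡ-≤ (rank (∁ Y)) (rank-bounded (Y ─ X))) ⟩
    ∣ X ∣ + (∣ Y ─ X ∣ + rank (∁ Y))    ≡⟨ +-assoc ∣ X ∣ ∣ Y ─ X ∣ (rank (∁ Y)) ⟨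
    ∣ X ∣ + ∣ Y ─ X ∣ + rank (∁ Y)      ≡⟨ cong (_+ rank (∁ Y)) (p⊆q⇒∣p∣+∣q─p∣≡∣q∣ X⊆Y) ⟩
    ∣ Y ∣ + rank (∁ Y)                  ≡⟨ rank*+rank⊤ Y ⟨
    rank* Y + rank ⊤                    ∎)
    where
    open ≤-Reasoning
    ∁X⊆[Y─X]∪∁Y : ∁ X ⊆ (Y ─ X) ∪ ∁ Y
    ∁X⊆[Y─X]∪∁Y {e} e∈∁X with e ∈? Y
    ... | yes e∈Y = x∈p∪q⁺ (inj₁ (x∈p∧x∉q⇒x∈p─q e∈Y (x∈∁p⇒x∉p e∈∁X)))
    ... | no  e∉Y = x∈p∪q⁺ (inj₂ (x∉p⇒x∈∁p e∉Y))

  ∣∣+rank∁-submodular : ∀ X Y → (∣ X ∪ Y ∣ + rank (∁ (X ∪ Y))) + (∣ X ∩ Y ∣ + rank (∁ (X ∩ Y)))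
                              ≤ (∣ X ∣ + rank (∁ X)) + (∣ Y ∣ + rank (∁ Y))
  ∣∣+rank∁-submodular X Y = begin
    (∣ X ∪ Y ∣ + rank (∁ (X ∪ Y))) + (∣ X ∩ Y ∣ + rank (∁ (X ∩ Y)))
      ≡⟨ interchange (∣ X ∪ Y ∣) _ (∣ X ∩ Y ∣) _ ⟩
    (∣ X ∪ Y ∣ + ∣ X ∩ Y ∣) + (rank (∁ (X ∪ Y)) + rank (∁ (X ∩ Y)))
      ≡⟨ cong₂ _+_ (∣p∪q∣+∣p∩q∣≡∣p∣+∣q∣ X Y) (+-comm (rank (∁ (X ∪ Y))) _) ⟩
    (∣ X ∣ + ∣ Y ∣) + (rank (∁ (X ∩ Y)) + rank (∁ (X ∪ Y)))
      ≤⟨ +-monoʳ-≤ (∣ X ∣ + ∣ Y ∣)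
           (rank-submodular-⊆ (⊆-reflexive (deMorgan₁ X Y)) (⊆-reflexive (deMorgan₂ X Y))) ⟩
    (∣ X ∣ + ∣ Y ∣) + (rank (∁ X) + rank (∁ Y))
      ≡⟨ interchange (∣ X ∣) (∣ Y ∣) _ _ ⟩
    (∣ X ∣ + rank (∁ X)) + (∣ Y ∣ + rank (∁ Y))
      ∎
    where open ≤-Reasoning

  rank*-submodular : ∀ X Y → rank* (X ∪ Y) + rank* (X ∩ Y) ≤ rank* X + rank* Y
  rank*-submodular X Y = +-cancelʳ-≤ (rank ⊤ + rank ⊤) _ _ (begin
    (rank* (X ∪ Y) + rank* (X ∩ Y)) + (rank ⊤ + rank ⊤)
      ≡⟨ interchange (rank* (X ∪ Y)) _ (rank ⊤) _ ⟩
    (rank* (X ∪ Y) + rank ⊤) + (rank* (X ∩ Y) + rank ⊤)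
      ≡⟨ cong₂ _+_ (rank*+rank⊤ (X ∪ Y)) (rank*+rank⊤ (X ∩ Y)) ⟩
    (∣ X ∪ Y ∣ + rank (∁ (X ∪ Y))) + (∣ X ∩ Y ∣ + rank (∁ (X ∩ Y)))
      ≤⟨ ∣∣+rank∁-submodular X Y ⟩
    (∣ X ∣ + rank (∁ X)) + (∣ Y ∣ + rank (∁ Y))
      ≡⟨ cong₂ _+_ (rank*+rank⊤ X) (rank*+rank⊤ Y) ⟨
    (rank* X + rank ⊤) + (rank* Y + rank ⊤)
      ≡⟨ interchange (rank* X) _ (rank ⊤) _ ⟨
    (rank* X + rank* Y) + (rank ⊤ + rank ⊤)
      ∎)
    where open ≤-Reasoning

  dual : RankFunction n
  dual = record
    { rank            = rank*
    ; rank-bounded    = rank*-bounded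
    ; rank-mono       = rank*-mono
    ; rank-submodular = rank*-submodular
    }

  independent*⇔rank∁≡rank⊤ : ∀ {I} → Independent dual I ⇔ rank (∁ I) ≡ rank ⊤
  independent*⇔rank∁≡rank⊤ {I} = mk⇔
    (λ rank*I≡∣I∣ → +-cancelˡ-≡ ∣ I ∣ (rank (∁ I)) (rank ⊤)
                      (trans (sym (rank*+rank⊤ I)) (cong (_+ rank ⊤) rank*I≡∣I∣)))
    (λ rank∁I≡rank⊤ → +-cancelʳ-≡ (rank ⊤) (rank* I) ∣ I ∣
                        (trans (rank*+rank⊤ I) (cong (∣ I ∣ +_) rank∁I≡rank⊤)))

  flat*⇒cyclic∁ : ∀ {Z} → Flat dual Z → Cyclic ρ (∁ Z)
  flat*⇒cyclic∁ {Z} Z-flat* e e∈∁Z = ≤-trans step (rank-mono ∁[Z∪⁅e⁆]⊆∁Z-e)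
    where
    e∉Z : e ∉ Z
    e∉Z = x∈∁p⇒x∉p e∈∁Z
    step : rank (∁ Z) ≤ rank (∁ (Z ∪ ⁅ e ⁆))
    step = +-cancelˡ-≤ (suc ∣ Z ∣) (rank (∁ Z)) (rank (∁ (Z ∪ ⁅ e ⁆))) (begin
      suc (∣ Z ∣ + rank (∁ Z))                   ≡⟨ cong suc (rank*+rank⊤ Z) ⟨
      suc (rank* Z + rank ⊤)                     ≤⟨ +-monoˡ-≤ (rank ⊤) (Z-flat* e e∉Z) ⟩
      rank* (Z ∪ ⁅ e ⁆) + rank ⊤                 ≡⟨ rank*+rank⊤ (Z ∪ ⁅ e ⁆) ⟩
      ∣ Z ∪ ⁅ e ⁆ ∣ + rank (∁ (Z ∪ ⁅ e ⁆))       ≡⟨ cong (_+ rank (∁ (Z ∪ ⁅ e ⁆))) (x∉p⇒∣p∪⁅x⁆∣≡1+∣p∣ Z e∉Z) ⟩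
      suc ∣ Z ∣ + rank (∁ (Z ∪ ⁅ e ⁆))           ∎)
      where open ≤-Reasoning
    ∁[Z∪⁅e⁆]⊆∁Z-e : ∁ (Z ∪ ⁅ e ⁆) ⊆ ∁ Z - e
    ∁[Z∪⁅e⁆]⊆∁Z-e x∈∁[Z∪⁅e⁆] = let x∉Z∪⁅e⁆ = x∈∁p⇒x∉p x∈∁[Z∪⁅e⁆] in
      x∈p∧x∉q⇒x∈p─q (x∉p⇒x∈∁p (x∉Z∪⁅e⁆ ∘ p⊆p∪q ⁅ e ⁆)) (x∉Z∪⁅e⁆ ∘ q⊆p∪q Z ⁅ e ⁆)

  cyclic*⇒flat∁ : ∀ {Z} → Cyclic dual Z → Flat ρ (∁ Z)
  cyclic*⇒flat∁ {Z} Z-cyclic* e e∉∁Z = ≤-trans step (rank-mono ∁[Z-e]⊆∁Z∪⁅e⁆)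
    where
    e∈Z : e ∈ Z
    e∈Z = x∉∁p⇒x∈p e∉∁Z
    step : suc (rank (∁ Z)) ≤ rank (∁ (Z - e))
    step = +-cancelˡ-≤ ∣ Z - e ∣ (suc (rank (∁ Z))) (rank (∁ (Z - e))) (begin
      ∣ Z - e ∣ + suc (rank (∁ Z))      ≡⟨ +-suc ∣ Z - e ∣ (rank (∁ Z)) ⟩
      suc ∣ Z - e ∣ + rank (∁ Z)        ≡⟨ cong (_+ rank (∁ Z)) (x∈p⇒1+∣p-x∣≡∣p∣ e∈Z) ⟩
      ∣ Z ∣ + rank (∁ Z)                ≡⟨ rank*+rank⊤ Z ⟨
      rank* Z + rank ⊤                  ≤⟨ +-monoˡ-≤ (rank ⊤) (Z-cyclic* e e∈Z) ⟩
      rank* (Z - e) + rank ⊤            ≡⟨ rank*+rank⊤ (Z - e) ⟩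
      ∣ Z - e ∣ + rank (∁ (Z - e))      ∎)
      where open ≤-Reasoning
    ∁[Z-e]⊆∁Z∪⁅e⁆ : ∁ (Z - e) ⊆ ∁ Z ∪ ⁅ e ⁆
    ∁[Z-e]⊆∁Z∪⁅e⁆ {x} x∈∁[Z-e] with x ≟ᶠ e
    ... | yes refl = x∈p∪q⁺ (inj₂ (x∈⁅x⁆ x))
    ... | no  x≢e  = x∈p∪q⁺ (inj₁ (x∉p⇒x∈∁p λ x∈Z → x∈∁p⇒x∉p x∈∁[Z-e] (x∈p∧x≢y⇒x∈p-y x∈Z x≢e)))

  cyclicFlat*⇒cyclicFlat∁ : ∀ {Z} → CyclicFlat dual Z → CyclicFlat ρ (∁ Z)
  cyclicFlat*⇒cyclicFlat∁ (Z-flat* , Z-cyclic*) = cyclic*⇒flat∁ Z-cyclic* , flat*⇒cyclic∁ Z-flat*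

  width≤2-dual : Width≤2 (CyclicFlat ρ) → Width≤2 (CyclicFlat dual)
  width≤2-dual width X-cf Y-cf Z-cf (X∥Y , X∥Z , Y∥Z) =
    width (cyclicFlat*⇒cyclicFlat∁ X-cf) (cyclicFlat*⇒cyclicFlat∁ Y-cf) (cyclicFlat*⇒cyclicFlat∁ Z-cf)
          (∥-∁ X∥Y , ∥-∁ X∥Z , ∥-∁ Y∥Z)

module MatroidRank {n : ℕ} (M : Matroid n) where
  open Matroid M

  IndependentIn : Subset n → Subset n → Set
  IndependentIn X I = I ⊆ X × Indep I

  IsBasisOf : Subset n → Subset n → Set
  IsBasisOf X = Maximal (IndependentIn X)

  basis-extension : ∀ {X I} → IndependentIn X I → ∃ λ B → I ⊆ B × IsBasisOf X B
  basis-extension {X} = maximal (λ I → I ⊆? X ×-dec Indep? I)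

  basisOf : ∀ X → ∃ (IsBasisOf X)
  basisOf X = let B , _ , B-basis = basis-extension {X} (⊥⊆ , indep-⊥) in B , B-basis

  ∣independent∣≤∣basis∣ : ∀ {X B I} → IsBasisOf X B → IndependentIn X I → ∣ I ∣ ≤ ∣ B ∣
  ∣independent∣≤∣basis∣ {B = B} ((B⊆X , B-indep) , B-max) (I⊆X , I-indep) = ≮⇒≥ λ ∣B∣<∣I∣ →
    let e , e∈I , e∉B , B∪e-indep = augment B-indep I-indep ∣B∣<∣I∣
    in e∉B (B-max (∪-least B⊆X (x∈p⇒⁅x⁆⊆p (I⊆X e∈I)) , B∪e-indep) (p⊆p∪q ⁅ e ⁆) (q⊆p∪q B ⁅ e ⁆ (x∈⁅x⁆ e)))

  rank : Subset n → ℕ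
  rank X = ∣ proj₁ (basisOf X) ∣

  ∣independent∣≤rank : ∀ {X I} → IndependentIn X I → ∣ I ∣ ≤ rank X
  ∣independent∣≤rank {X} = ∣independent∣≤∣basis∣ (proj₂ (basisOf X))

  ∣basis∣≡rank : ∀ {X B} → IsBasisOf X B → ∣ B ∣ ≡ rank X
  ∣basis∣≡rank {X} B-basis =
    ≤-antisym (∣independent∣≤rank (proj₁ B-basis)) (∣independent∣≤∣basis∣ B-basis (proj₁ (proj₂ (basisOf X))))

  rank-bounded : ∀ X → rank X ≤ ∣ X ∣
  rank-bounded X = p⊆q⇒∣p∣≤∣q∣ (proj₁ (proj₁ (proj₂ (basisOf X))))

  rank-mono : ∀ {X Y} → X ⊆ Y → rank X ≤ rank Y
  rank-mono {X} X⊆Y = let B⊆X , B-indep = proj₁ (proj₂ (basisOf X)) in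
    ∣independent∣≤rank (⊆-trans B⊆X X⊆Y , B-indep)

  rank-submodular : ∀ X Y → rank (X ∪ Y) + rank (X ∩ Y) ≤ rank X + rank Y
  rank-submodular X Y with basisOf (X ∩ Y)
  ... | I , I-basis@((I⊆X∩Y , I-indep) , _)
    with basis-extension {X ∪ Y} (p⊆p∪q Y ∘ p∩q⊆p X Y ∘ I⊆X∩Y , I-indep)
  ... | J , I⊆J , J-basis@((J⊆X∪Y , J-indep) , _) = begin
    rank (X ∪ Y) + rank (X ∩ Y)
      ≡⟨ cong₂ _+_ (∣basis∣≡rank J-basis) (∣basis∣≡rank I-basis) ⟨
    ∣ J ∣ + ∣ I ∣
      ≤⟨ +-mono-≤ (p⊆q⇒∣p∣≤∣q∣ J⊆[J∩X]∪[J∩Y]) (p⊆q⇒∣p∣≤∣q∣ I⊆[J∩X]∩[J∩Y]) ⟩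
    ∣ J ∩ X ∪ J ∩ Y ∣ + ∣ (J ∩ X) ∩ (J ∩ Y) ∣
      ≡⟨ ∣p∪q∣+∣p∩q∣≡∣p∣+∣q∣ (J ∩ X) (J ∩ Y) ⟩
    ∣ J ∩ X ∣ + ∣ J ∩ Y ∣
      ≤⟨ +-mono-≤ (∣J∩Z∣≤rankZ X) (∣J∩Z∣≤rankZ Y) ⟩
    rank X + rank Y
      ∎
    where
    open ≤-Reasoning
    ∣J∩Z∣≤rankZ : ∀ Z → ∣ J ∩ Z ∣ ≤ rank Z
    ∣J∩Z∣≤rankZ Z = ∣independent∣≤rank (p∩q⊆q J Z , indep-⊆ (p∩q⊆p J Z) J-indep)
    J⊆[J∩X]∪[J∩Y] : J ⊆ J ∩ X ∪ J ∩ Y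
    J⊆[J∩X]∪[J∩Y] e∈J with x∈p∪q⁻ X Y (J⊆X∪Y e∈J)
    ... | inj₁ e∈X = x∈p∪q⁺ (inj₁ (x∈p∩q⁺ (e∈J , e∈X)))
    ... | inj₂ e∈Y = x∈p∪q⁺ (inj₂ (x∈p∩q⁺ (e∈J , e∈Y)))
    I⊆[J∩X]∩[J∩Y] : I ⊆ (J ∩ X) ∩ (J ∩ Y)
    I⊆[J∩X]∩[J∩Y] = ∩-greatest (∩-greatest I⊆J (p∩q⊆p X Y ∘ I⊆X∩Y)) (∩-greatest I⊆J (p∩q⊆q X Y ∘ I⊆X∩Y))

  matroidRank : RankFunction n
  matroidRank = record
    { rank            = rank
    ; rank-bounded    = rank-bounded
    ; rank-mono       = rank-mono
    ; rank-submodular = rank-submodular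
    }

  indep⇔independent : ∀ {I} → Indep I ⇔ Independent matroidRank I
  indep⇔independent {I} = mk⇔
    (λ I-indep → ≤-antisym (rank-bounded I) (∣independent∣≤rank (⊆-refl , I-indep)))
    (λ rankI≡∣I∣ → let B , (B⊆I , B-indep) , _ = basisOf I in
       indep-⊆ (p⊆q∧∣q∣≤∣p∣⇒q⊆p B⊆I (≤-reflexive (sym rankI≡∣I∣))) B-indep)

  dualIndep⇔rank∁≡rank⊤ : ∀ {I} → DualIndep M I ⇔ rank (∁ I) ≡ rank ⊤
  dualIndep⇔rank∁≡rank⊤ {I} = mk⇔ to from
    where
    to : DualIndep M I → rank (∁ I) ≡ rank ⊤
    to (B , (B-indep , B-max) , I⊆∁B) = ≤-antisym (rank-mono ⊆⊤) (begin
      rank ⊤     ≡⟨ ∣basis∣≡rank {⊤} ((⊆⊤ , B-indep) , λ (_ , Z-indep) B⊆Z → B-max _ Z-indep B⊆Z) ⟨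
      ∣ B ∣      ≤⟨ ∣independent∣≤rank (p⊆∁q⇒q⊆∁p I⊆∁B , B-indep) ⟩
      rank (∁ I) ∎)
      where open ≤-Reasoning
    from : rank (∁ I) ≡ rank ⊤ → DualIndep M I
    from rank∁I≡rank⊤ = let B , (B⊆∁I , B-indep) , _ = basisOf (∁ I) in
      B , (B-indep , λ J J-indep B⊆J → p⊆q∧∣q∣≤∣p∣⇒q⊆p B⊆J
             (≤-trans (∣independent∣≤rank (⊆⊤ , J-indep)) (≤-reflexive (sym rank∁I≡rank⊤)))) ,
      p⊆∁q⇒q⊆∁p B⊆∁I

  hasRank⇒≡rank : ∀ {X k} → HasRank M X k → k ≡ rank X
  hasRank⇒≡rank {X} ((I , I⊆X , I-indep , ∣I∣≡k) , k-max) = ≤-antisym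
    (subst (_≤ rank X) ∣I∣≡k (∣independent∣≤rank (I⊆X , I-indep)))
    (let B , (B⊆X , B-indep) , _ = basisOf X in k-max B B⊆X B-indep)

  flat⇒isFlat : ∀ {F} → Flat matroidRank F → IsFlat M F
  flat⇒isFlat F-flat e e∉F k F-rank F∪e-rank =
    <⇒≢ (F-flat e e∉F) (trans (sym (hasRank⇒≡rank F-rank)) (hasRank⇒≡rank F∪e-rank))

  minimalDependent⇒circuit : ∀ {X C} → Minimal (λ C → C ⊆ X × ¬ Indep C) C → IsCircuit M C
  minimalDependent⇒circuit {X} {C} ((C⊆X , C-dep) , C-min) = C-dep , D⊂C⇒indep
    where
    D⊂C⇒indep : ∀ D → D ⊂ C → Indep D
    D⊂C⇒indep D (D⊆C , x , x∈C , x∉D) with Indep? D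
    ... | yes D-indep = D-indep
    ... | no  D-dep   = contradiction (C-min (⊆-trans D⊆C C⊆X , D-dep) D⊆C x∈C) x∉D

  dependent⊆J∪e⇒∋e : ∀ {J C e} → Indep J → C ⊆ J ∪ ⁅ e ⁆ → ¬ Indep C → e ∈ C
  dependent⊆J∪e⇒∋e {J} {C} {e} J-indep C⊆J∪e C-dep with e ∈? C
  ... | yes e∈C = e∈C
  ... | no  e∉C = contradiction (indep-⊆ C⊆J J-indep) C-dep
    where
    C⊆J : C ⊆ J
    C⊆J {x} x∈C with x∈p∪q⁻ J ⁅ e ⁆ (C⊆J∪e x∈C)
    ... | inj₁ x∈J   = x∈J
    ... | inj₂ x∈⁅e⁆ = contradiction (subst (_∈ C) (x∈⁅y⁆⇒x≡y e x∈⁅e⁆) x∈C) e∉C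

  basis∪e-dependent : ∀ {F J e} → Cyclic matroidRank F → e ∈ F → IsBasisOf (F - e) J → ¬ Indep (J ∪ ⁅ e ⁆)
  basis∪e-dependent {F} {J} {e} F-cyclic e∈F J-basis@((J⊆F-e , _) , _) J∪e-indep = n≮n ∣ J ∣ (begin
    suc ∣ J ∣      ≡⟨ x∉p⇒∣p∪⁅x⁆∣≡1+∣p∣ J e∉J ⟨
    ∣ J ∪ ⁅ e ⁆ ∣  ≤⟨ ∣independent∣≤rank (p⊆q-x∧x∈q⇒p∪⁅x⁆⊆q J⊆F-e e∈F , J∪e-indep) ⟩
    rank F         ≤⟨ F-cyclic e e∈F ⟩
    rank (F - e)   ≡⟨ ∣basis∣≡rank J-basis ⟨
    ∣ J ∣          ∎)
    where
    open ≤-Reasoning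
    e∉J : e ∉ J
    e∉J e∈J = x∈p─q⇒x∉q F ⁅ e ⁆ (J⊆F-e e∈J) (x∈⁅x⁆ e)

  cyclic⇒isCyclic : ∀ {F} → Cyclic matroidRank F → IsCyclic M F
  cyclic⇒isCyclic {F} F-cyclic e e∈F with basisOf (F - e)
  ... | J , J-basis@((J⊆F-e , J-indep) , _)
    with minimal (λ C → C ⊆? J ∪ ⁅ e ⁆ ×-dec ¬? (Indep? C)) (⊆-refl , basis∪e-dependent F-cyclic e∈F J-basis)
  ... | C , C-minimal@((C⊆J∪e , C-dep) , _) =
    C , minimalDependent⇒circuit C-minimal , dependent⊆J∪e⇒∋e J-indep C⊆J∪e C-dep ,
    ⊆-trans C⊆J∪e (p⊆q-x∧x∈q⇒p∪⁅x⁆⊆q J⊆F-e e∈F)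

  cyclicWidth≤2⇒width≤2 : CyclicWidth≤ M 2 → Width≤2 (CyclicFlat matroidRank)
  cyclicWidth≤2⇒width≤2 cyclicWidth≤2 {X} {Y} {Z} (X-flat , X-cyclic) (Y-flat , Y-cyclic) (Z-flat , Z-cyclic)
                        ((X⊈Y , Y⊈X) , (X⊈Z , Z⊈X) , (Y⊈Z , Z⊈Y)) =
    <⇒≱ (n<1+n 2) (cyclicWidth≤2 3 F (F-cyclicFlat , F-incomparable))
    where
    F : Fin 3 → Subset n
    F zero             = X
    F (suc zero)       = Y
    F (suc (suc zero)) = Z
    F-cyclicFlat : ∀ i → IsCyclicFlat M (F i)
    F-cyclicFlat zero             = flat⇒isFlat X-flat , cyclic⇒isCyclic X-cyclic
    F-cyclicFlat (suc zero)       = flat⇒isFlat Y-flat , cyclic⇒isCyclic Y-cyclic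
    F-cyclicFlat (suc (suc zero)) = flat⇒isFlat Z-flat , cyclic⇒isCyclic Z-cyclic
    F-incomparable : ∀ i j → i ≢ j → ¬ (F i ⊆ F j)
    F-incomparable zero             zero             i≢j = contradiction refl i≢j
    F-incomparable zero             (suc zero)       _   = X⊈Y
    F-incomparable zero             (suc (suc zero)) _   = X⊈Z
    F-incomparable (suc zero)       zero             _   = Y⊈X
    F-incomparable (suc zero)       (suc zero)       i≢j = contradiction refl i≢j
    F-incomparable (suc zero)       (suc (suc zero)) _   = Y⊈Z
    F-incomparable (suc (suc zero)) zero             _   = Z⊈X
    F-incomparable (suc (suc zero)) (suc zero)       _   = Z⊈Y
    F-incomparable (suc (suc zero)) (suc (suc zero)) i≢j = contradiction refl i≢j

isTransversalIndep-⇔ : {P Q : Subset n → Set} → (∀ {I} → P I ⇔ Q I) →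
                       IsTransversalIndep Q → IsTransversalIndep P
isTransversalIndep-⇔ P⇔Q (r , A , Q⇔PT) = r , A , λ I → Q⇔PT I ⇔-∘ P⇔Q

theorem5p6 : (n : ℕ) (M : Matroid n) → CyclicWidth≤ M 2 → IsBitransversal M
theorem5p6 n M cyclicWidth≤2 =
    isTransversalIndep-⇔ indep⇔independent (transversal ρ width)
  , isTransversalIndep-⇔ (⇔-sym (independent*⇔rank∁≡rank⊤ ρ) ⇔-∘ dualIndep⇔rank∁≡rank⊤)
                         (transversal (dual ρ) (width≤2-dual ρ width))
  where
  open MatroidRank M
  open CyclicFlatPresentation using (transversal)
  open Dual using (dual; width≤2-dual; independent*⇔rank∁≡rank⊤)
  ρ : RankFunction n
  ρ = matroidRank
  width : Width≤2 (CyclicFlat ρ)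
  width = cyclicWidth≤2⇒width≤2 cyclicWidth≤2
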